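{- Let $s,k\ge 2$ and $q\ge1$ be integers and define $g(t)=g_{s,k}(t)=\sum_{\deg Y=k-1}\sum_{\deg Z=s-1}E(tYZ)$ for $t\in\mathbb{P}$, where $Y,Z$ range over polynomials in $\mathbb{F}_2[T]$ of exact degree $k-1$ and $s-1$. Then for $t\in\mathbb{P}$: $g(t)=2^{s+k-j-2}$ if $r(D_{(s-1)\times(k-1)}(t))=r(D_{s\times(k-1)}(t))=r(D_{(s-1)\times k}(t))=r(D_{s\times k}(t))=j$; $g(t)=-2^{s+k-j-2}$ if $r(D_{(s-1)\times(k-1)}(t))=r(D_{s\times(k-1)}(t))=r(D_{(s-1)\times k}(t))=j$ and $r(D_{s\times k}(t))=j+1$; and $g(t)=0$ otherwise. Moreover $$\int_{\mathbb{P}}g^{2q}(t)\,dt=2^{(s+k-2)(2q-1)}\sum_{j=0}^{s-1}N_j\,2^{ -2qj},$$ where $N_j$ is the number of $(\alpha_1,\dots,\alpha_{k+s-1})\in\mathbb{F}_2^{k+s-1}$ such that the four matrices $D_{(s-1)\times(k-1)}$, $D_{(s-1)\times k}$, $D_{s\times(k-1)}$, $D_{s\times k}$ built from $(\alpha_{i+j-1})$ all have rank $j$.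
   Context: $\mathbb{K}=\mathbb{F}_2((T^{ -1}))$; $\mathbb{P}=\{t\in\mathbb{K}:|t|<1\}=\{\sum_{i\ge1}\alpha_iT^{ -i}\}$ with Haar measure $dt$ normalized so $\int_{\mathbb{P}}dt=1$. $E(t)=(-1)^{\alpha_1}$ where $\alpha_1$ is the coefficient of $T^{ -1}$ in $t$. For $t=\sum_{i\ge1}\alpha_iT^{ -i}$ and positive integers $a,b$, $D_{a\times b}(t)=(\alpha_{i+j-1})_{1\le i\le a,1\le j\le b}$ (persymmetric matrix over $\mathbb{F}_2$), and $r$ denotes rank over $\mathbb{F}_2$. -}

module Defs where

open import Data.Bool using (Bool; true; false; not; _∧_; _xor_; if_then_else_)
open import Data.Nat as ℕ using (ℕ; zero; suc; _⊔_; _∸_)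
open import Data.Integer as ℤ using (ℤ; +_; -_)
open import Data.Rational as ℚ using (ℚ; _/_)
open import Data.List as List using (List; []; _∷_; [_]; concatMap; foldr; map; filter; _++_)
open import Data.Vec as Vec using (Vec; []; _∷_; toList; zipWith; replicate)
open import Data.Fin using (Fin; toℕ)
open import Relation.Binary.PropositionalEquality using (_≡_)
open import Relation.Nullary.Decidable using (Dec)

-- An element t = Σ_{i≥1} α_i T^{-i} of ℙ is represented by the sequence
-- t : ℕ → Bool with  t n = α_{n+1}  (true = 1 ∈ 𝔽₂).
Seq : Set
Seq = ℕ → Bool

allVecs : (n : ℕ) → List (Vec Bool n)
allVecs zero = [] ∷ []
allVecs (suc n) = concatMap (λ v → (false ∷ v) ∷ (true ∷ v) ∷ []) (allVecs n)

Matrix : ℕ → ℕ → Set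
Matrix m n = Vec (Vec Bool n) m

isZero : ∀ {n} → Vec Bool n → Bool
isZero [] = true
isZero (b ∷ v) = not b ∧ isZero v

combo : ∀ {m n} → Vec Bool m → Matrix m n → Vec Bool n
combo {n = n} [] [] = replicate n false
combo (c ∷ cs) (r ∷ rs) = if c then zipWith _xor_ r (combo cs rs) else combo cs rs

subsetOf : ∀ {m} → Vec Bool m → Vec Bool m → Bool
subsetOf [] [] = true
subsetOf (c ∷ cs) (s ∷ ss) = (not c ∨' s) ∧ subsetOf cs ss
  where
  _∨'_ : Bool → Bool → Bool
  true ∨' _ = true
  false ∨' b = b

allB : ∀ {A : Set} → (A → Bool) → List A → Bool
allB p = foldr (λ x b → p x ∧ b) true

count : ∀ {m} → Vec Bool m → ℕ
count [] = 0
count (true ∷ v) = suc (count v)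
count (false ∷ v) = count v

independentRows : ∀ {m n} → Matrix m n → Vec Bool m → Bool
independentRows {m} M S =
  allB (λ c → not (subsetOf c S ∧ not (isZero c) ∧ isZero (combo c M))) (allVecs m)

maxList : List ℕ → ℕ
maxList = foldr _⊔_ 0

rank : ∀ {m n} → Matrix m n → ℕ
rank {m} M = maxList (map count (filter (λ S → independentRows M S Data.Bool.≟ true) (allVecs m)))
  where import Data.Bool

D : (a b : ℕ) → Seq → Matrix a b
D a b t = Vec.tabulate (λ i → Vec.tabulate (λ j → t (toℕ i ℕ.+ toℕ j)))

-- Polynomials in 𝔽₂[T] as coefficient lists (constant term first)

polyAdd : List Bool → List Bool → List Bool
polyAdd [] q = q
polyAdd (a ∷ p) [] = a ∷ p
polyAdd (a ∷ p) (b ∷ q) = (a xor b) ∷ polyAdd p q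

polyMul : List Bool → List Bool → List Bool
polyMul [] q = []
polyMul (a ∷ p) q = polyAdd (if a then q else []) (false ∷ polyMul p q)

-- coefficient of T^{-1} in t·P, for P = Σ_m p_m T^m :  Σ_m p_m α_{m+1}
coefT⁻¹ : Seq → List Bool → Bool
coefT⁻¹ t [] = false
coefT⁻¹ t (p ∷ ps) = (p ∧ t 0) xor coefT⁻¹ (λ n → t (suc n)) ps

E : Seq → List Bool → ℤ
E t P = if coefT⁻¹ t P then - (+ 1) else + 1

monic : ∀ {d} → Vec Bool d → List Bool
monic v = toList v ++ [ true ]

sumℤ : List ℤ → ℤ
sumℤ = foldr ℤ._+_ (+ 0)

g : (s k : ℕ) → Seq → ℤ
g s k t = sumℤ (map (λ y → sumℤ (map (λ z → E t (polyMul (monic y) (monic z)))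
                                    (allVecs (s ∸ 1))))
                    (allVecs (k ∸ 1)))

extend : ∀ {n} → Vec Bool n → Seq
extend [] _ = false
extend (b ∷ v) zero = b
extend (b ∷ v) (suc i) = extend v i

FourRanks : (s k j : ℕ) → Seq → Set
FourRanks s k j t =
  rank (D (s ∸ 1) (k ∸ 1) t) ≡ j × rank (D s (k ∸ 1) t) ≡ j ×
  rank (D (s ∸ 1) k t) ≡ j × rank (D s k t) ≡ j
  where open import Data.Product using (_×_)

fourRanks? : (s k j : ℕ) → Seq → Bool
fourRanks? s k j t =
  (rank (D (s ∸ 1) (k ∸ 1) t) ℕ.≡ᵇ j) ∧ (rank (D s (k ∸ 1) t) ℕ.≡ᵇ j) ∧
  (rank (D (s ∸ 1) k t) ℕ.≡ᵇ j) ∧ (rank (D s k t) ℕ.≡ᵇ j)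

N : (s k j : ℕ) → ℕ
N s k j = List.length (List.filter (λ α → fourRanks? s k j (extend α) Data.Bool.≟ true)
                                   (allVecs (k ℕ.+ s ∸ 1)))
  where import Data.Bool

powℚ : ℚ → ℕ → ℚ
powℚ x zero = ℚ.1ℚ
powℚ x (suc n) = x ℚ.* powℚ x n

sumℚ : List ℚ → ℚ
sumℚ = foldr ℚ._+_ ℚ.0ℚ

toℚ : ℤ → ℚ
toℚ z = z / 1

-- ∫_ℙ f(t) dt for f depending only on α_1,…,α_n :
-- average of f over 𝔽₂^n (Haar measure, total mass 1).
cylinderIntegral : (n : ℕ) → (Seq → ℚ) → ℚ
cylinderIntegral n f = powℚ ℚ.½ n ℚ.* sumℚ (map (λ α → f (extend α)) (allVecs n))

-- Writing Y and Z as monic polynomials and summing E(tYZ) over the lower coefficients of Y,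
-- orthogonality of characters gives g(t) = 2^{k-1}(2u − v), where u and v count the monic Z of
-- degree s − 1 for which the coefficients of T⁻¹, …, T⁻ᵏ, resp. T⁻¹, …, T⁻⁽ᵏ⁻¹⁾, of tZ vanish:
-- the kernel vectors with last coordinate 1 of D_{s×k}(t) and D_{s×(k-1)}(t).
-- Over 𝔽₂ a kernel has 2^(rows − rank) elements; appending a row adds nothing or a coset of the
-- old kernel, appending a column keeps or halves it. Comparing the kernels of D_{(s-1)×(k-1)},
-- D_{s×(k-1)}, D_{(s-1)×k}, D_{s×k} leaves u = v = X, or u = 0 and v = X, or 2u = v, where X is
-- the kernel size of D_{(s-1)×k}: these are the three cases of the formula.
-- As g only depends on α₁, …, α_{s+k-1}, the integral is an average over 𝔽₂^{s+k-1}; flipping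
-- α_{s+k-1}, which occurs only in the corner of D_{s×k}, exchanges the two nonzero cases, so
-- both occur N_j times.

module Submission where

open import Algebra.Bundles using (CommutativeRing; CommutativeSemigroup)
open import Algebra.Core using (Op₂)
open import Algebra.Structures using (IsCommutativeMonoid)
open import Data.Bool as Bool using (Bool; true; false; not; _∧_; _∨_; _xor_; if_then_else_; T)
open import Data.Bool.Properties
  using (xor-assoc; xor-comm; xor-identityˡ; xor-identityʳ; xor-same; true-xor; not-distribʳ-xor;
         not-involutive; ∧-assoc; ∧-zeroʳ; ∧-identityʳ; ∧-distribʳ-xor; ∧-conicalˡ; ∧-conicalʳ; ∨-zeroʳ;
         ∧-isCommutativeMonoid; ∨-isCommutativeMonoid; xor-∧-commutativeRing)
open import Data.Empty using (⊥; ⊥-elim)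
open import Data.Fin using (toℕ)
open import Data.Fin.Properties using (toℕ<n)
open import Data.Integer as ℤ using (ℤ; +_; -_; _-_) renaming (_^_ to _^ℤ_)
import Data.Integer.Properties as ℤₚ
open import Data.List as List using (List; []; _∷_; foldr; map; filter; length; upTo)
import Data.List.Properties as Listₚ
open import Data.List.Relation.Unary.All.Properties using (applyUpTo⁺₁)
open import Data.Nat as ℕ using (ℕ; zero; suc; _+_; _*_; _^_; _∸_; _≤_; _<_; _⊔_; z≤n; s≤s; _≡ᵇ_)
open import Data.Nat.ListAction using (sum)
open import Data.Nat.Properties
open import Data.Product using (_×_; _,_; proj₁; proj₂; Σ-syntax)
open import Data.Rational as ℚ using (ℚ; ½; 1ℚ) renaming (_*_ to _*ℚ_)
import Data.Rational.Properties as ℚₚ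
import Data.Rational.Unnormalised as ℚᵘ
import Data.Rational.Unnormalised.Properties as ℚᵘₚ
open import Data.Sum using (_⊎_; inj₁; inj₂)
open import Data.Unit using (tt)
open import Data.Vec using (Vec; []; _∷_; _∷ʳ_; zipWith; replicate; toList; tabulate)
open import Data.Vec.Properties
  using (zipWith-assoc; zipWith-comm; zipWith-identityˡ; zipWith-identityʳ; toList-∷ʳ; tabulate-cong)
open import Function using (id)
open import Level using (0ℓ)
open import Relation.Binary.Definitions using (tri<; tri≈; tri>)
open import Relation.Binary.PropositionalEquality
open import Relation.Nullary using (¬_)

open import Defs

infixl 6 _⊕_

_⊕_ : ∀ {n} → Vec Bool n → Vec Bool n → Vec Bool n
_⊕_ = zipWith _xor_

0ᵛ : ∀ {n} → Vec Bool n
0ᵛ = replicate _ false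

⊕-assoc : ∀ {n} (u v w : Vec Bool n) → (u ⊕ v) ⊕ w ≡ u ⊕ (v ⊕ w)
⊕-assoc = zipWith-assoc xor-assoc

⊕-comm : ∀ {n} (u v : Vec Bool n) → u ⊕ v ≡ v ⊕ u
⊕-comm = zipWith-comm xor-comm

⊕-identityˡ : ∀ {n} (u : Vec Bool n) → 0ᵛ ⊕ u ≡ u
⊕-identityˡ = zipWith-identityˡ xor-identityˡ

⊕-identityʳ : ∀ {n} (u : Vec Bool n) → u ⊕ 0ᵛ ≡ u
⊕-identityʳ = zipWith-identityʳ xor-identityʳ

⊕-self : ∀ {n} (u : Vec Bool n) → u ⊕ u ≡ 0ᵛ
⊕-self []      = refl
⊕-self (a ∷ u) = cong₂ _∷_ (xor-same a) (⊕-self u)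

⊕-cancelʳ : ∀ {n} (u v : Vec Bool n) → (u ⊕ v) ⊕ v ≡ u
⊕-cancelʳ u v = trans (⊕-assoc u v v) (trans (cong (u ⊕_) (⊕-self v)) (⊕-identityʳ u))

isZero⇒≡0ᵛ : ∀ {n} (v : Vec Bool n) → isZero v ≡ true → v ≡ 0ᵛ
isZero⇒≡0ᵛ []          _ = refl
isZero⇒≡0ᵛ (false ∷ v) z = cong (false ∷_) (isZero⇒≡0ᵛ v z)

isZero-0ᵛ : ∀ n → isZero (0ᵛ {n}) ≡ true
isZero-0ᵛ zero    = refl
isZero-0ᵛ (suc n) = isZero-0ᵛ n

isZero-⊕⇒≡ : ∀ {n} (u v : Vec Bool n) → isZero (u ⊕ v) ≡ true → u ≡ v
isZero-⊕⇒≡ u v z = begin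
  u             ≡⟨ sym (⊕-cancelʳ u v) ⟩
  (u ⊕ v) ⊕ v   ≡⟨ cong (_⊕ v) (isZero⇒≡0ᵛ (u ⊕ v) z) ⟩
  0ᵛ ⊕ v        ≡⟨ ⊕-identityˡ v ⟩
  v             ∎
  where open ≡-Reasoning

isZero-⊕-self : ∀ {n} (v : Vec Bool n) → isZero (v ⊕ v) ≡ true
isZero-⊕-self {n} v = trans (cong isZero (⊕-self v)) (isZero-0ᵛ n)

⊕-isCommutativeMonoid : ∀ {n} → IsCommutativeMonoid _≡_ (_⊕_ {n}) 0ᵛ
⊕-isCommutativeMonoid = record
  { isMonoid = record
    { isSemigroup = record
      { isMagma = record { isEquivalence = isEquivalence ; ∙-cong = cong₂ _⊕_ }
      ; assoc   = ⊕-assoc }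
    ; identity = ⊕-identityˡ , ⊕-identityʳ }
  ; comm = ⊕-comm }

xor-isCommutativeMonoid : IsCommutativeMonoid _≡_ _xor_ false
xor-isCommutativeMonoid = CommutativeRing.+-isCommutativeMonoid xor-∧-commutativeRing

commutativeSemigroup : ∀ {A : Set} {_∙_ : Op₂ A} {ε : A} →
                       IsCommutativeMonoid _≡_ _∙_ ε → CommutativeSemigroup 0ℓ 0ℓ
commutativeSemigroup isCM =
  record { isCommutativeSemigroup = IsCommutativeMonoid.isCommutativeSemigroup isCM }

open import Algebra.Properties.CommutativeSemigroup (commutativeSemigroup xor-isCommutativeMonoid)
  using () renaming (interchange to xor-interchange)

module CubeSum {A : Set} {_∙_ : Op₂ A} {ε : A} (isCM : IsCommutativeMonoid _≡_ _∙_ ε) where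

  open IsCommutativeMonoid isCM using (assoc; identityˡ; identityʳ; comm)
  open import Algebra.Properties.CommutativeSemigroup (commutativeSemigroup isCM) using (interchange)

  ∑ : (n : ℕ) → (Vec Bool n → A) → A
  ∑ zero    f = f []
  ∑ (suc n) f = ∑ n (λ v → f (false ∷ v) ∙ f (true ∷ v))

  ∑-cong : ∀ n {f g : Vec Bool n → A} → (∀ v → f v ≡ g v) → ∑ n f ≡ ∑ n g
  ∑-cong zero    f≗g = f≗g []
  ∑-cong (suc n) f≗g = ∑-cong n (λ v → cong₂ _∙_ (f≗g (false ∷ v)) (f≗g (true ∷ v)))

  ∑-distrib : ∀ n (f g : Vec Bool n → A) → ∑ n (λ v → f v ∙ g v) ≡ ∑ n f ∙ ∑ n g
  ∑-distrib zero    f g = refl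
  ∑-distrib (suc n) f g = trans (∑-cong n (λ v → interchange _ _ _ _)) (∑-distrib n _ _)

  ∑-ε : ∀ n → ∑ n (λ _ → ε) ≡ ε
  ∑-ε zero    = refl
  ∑-ε (suc n) = trans (∑-cong n (λ _ → identityˡ ε)) (∑-ε n)

  ∑-head : ∀ n (f : Vec Bool (suc n) → A) →
           ∑ (suc n) f ≡ ∑ n (λ v → f (false ∷ v)) ∙ ∑ n (λ v → f (true ∷ v))
  ∑-head n f = ∑-distrib n _ _

  ∑-last : ∀ n (f : Vec Bool (suc n) → A) →
           ∑ (suc n) f ≡ ∑ n (λ v → f (v ∷ʳ false)) ∙ ∑ n (λ v → f (v ∷ʳ true))
  ∑-last zero    f = refl
  ∑-last (suc n) f = begin
    ∑ (suc (suc n)) f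
      ≡⟨ ∑-head (suc n) f ⟩
    ∑ (suc n) (λ v → f (false ∷ v)) ∙ ∑ (suc n) (λ v → f (true ∷ v))
      ≡⟨ cong₂ _∙_ (∑-last n (λ v → f (false ∷ v))) (∑-last n (λ v → f (true ∷ v))) ⟩
    (∑ n (λ v → f (false ∷ (v ∷ʳ false))) ∙ ∑ n (λ v → f (false ∷ (v ∷ʳ true)))) ∙
    (∑ n (λ v → f (true ∷ (v ∷ʳ false))) ∙ ∑ n (λ v → f (true ∷ (v ∷ʳ true))))
      ≡⟨ interchange _ _ _ _ ⟩
    (∑ n (λ v → f (false ∷ (v ∷ʳ false))) ∙ ∑ n (λ v → f (true ∷ (v ∷ʳ false)))) ∙
    (∑ n (λ v → f (false ∷ (v ∷ʳ true))) ∙ ∑ n (λ v → f (true ∷ (v ∷ʳ true))))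
      ≡⟨ sym (cong₂ _∙_ (∑-head n (λ v → f (v ∷ʳ false)))
                        (∑-head n (λ v → f (v ∷ʳ true)))) ⟩
    ∑ (suc n) (λ v → f (v ∷ʳ false)) ∙ ∑ (suc n) (λ v → f (v ∷ʳ true))
      ∎
    where open ≡-Reasoning

  ∑-comm : ∀ m n (f : Vec Bool m → Vec Bool n → A) →
           ∑ m (λ u → ∑ n (f u)) ≡ ∑ n (λ v → ∑ m (λ u → f u v))
  ∑-comm zero    n f = refl
  ∑-comm (suc m) n f =
    trans (∑-cong m (λ u → sym (∑-distrib n _ _)))
          (∑-comm m n (λ u v → f (false ∷ u) v ∙ f (true ∷ u) v))

  ∑-translate : ∀ n (f : Vec Bool n → A) w → ∑ n (λ v → f (v ⊕ w)) ≡ ∑ n f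
  ∑-translate zero    f []          = refl
  ∑-translate (suc n) f (false ∷ w) = ∑-translate n _ w
  ∑-translate (suc n) f (true  ∷ w) = trans (∑-cong n (λ v → comm _ _)) (∑-translate n _ w)

  foldr-allVecs : ∀ n (f : Vec Bool n → A) → foldr _∙_ ε (map f (allVecs n)) ≡ ∑ n f
  foldr-allVecs zero    f = identityʳ (f [])
  foldr-allVecs (suc n) f = trans (doubling (allVecs n)) (foldr-allVecs n _)
    where
    doubling : ∀ vs →
               foldr _∙_ ε (map f (List.concatMap (λ v → (false ∷ v) ∷ (true ∷ v) ∷ []) vs))
               ≡ foldr _∙_ ε (map (λ v → f (false ∷ v) ∙ f (true ∷ v)) vs)
    doubling []       = refl
    doubling (v ∷ vs) = trans (cong (λ r → f (false ∷ v) ∙ (f (true ∷ v) ∙ r)) (doubling vs))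
                              (sym (assoc _ _ _))

module _ {A B : Set} {_∙_ : Op₂ A} {ε : A} {_◦_ : Op₂ B} {ε′ : B}
         (isA : IsCommutativeMonoid _≡_ _∙_ ε) (isB : IsCommutativeMonoid _≡_ _◦_ ε′) where

  ∑-homo : (h : A → B) → (∀ x y → h (x ∙ y) ≡ h x ◦ h y) →
           ∀ n f → h (CubeSum.∑ isA n f) ≡ CubeSum.∑ isB n (λ v → h (f v))
  ∑-homo h hom zero    f = refl
  ∑-homo h hom (suc n) f = trans (∑-homo h hom n _) (CubeSum.∑-cong isB n (λ v → hom _ _))

open CubeSum +-0-isCommutativeMonoid
module ℤ∑ = CubeSum ℤₚ.+-0-isCommutativeMonoid
open CubeSum ⊔-0-isCommutativeMonoid using () renaming (∑ to ⨆; foldr-allVecs to foldr-⊔-allVecs)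
open CubeSum ∧-isCommutativeMonoid using () renaming (∑ to ⋀; foldr-allVecs to foldr-∧-allVecs)
open CubeSum ∨-isCommutativeMonoid using () renaming (∑ to ⋁)

false≢true : false ≢ true
false≢true ()

m+m≡2*m : ∀ m → m + m ≡ 2 * m
m+m≡2*m m = cong (_+_ m) (sym (+-identityʳ m))

𝟙 : Bool → ℕ
𝟙 true  = 1
𝟙 false = 0

∑-one : ∀ n → ∑ n (λ _ → 1) ≡ 2 ^ n
∑-one zero    = refl
∑-one (suc n) = begin
  ∑ n (λ _ → 1 + 1)          ≡⟨ ∑-distrib n _ _ ⟩
  ∑ n (λ _ → 1) + ∑ n (λ _ → 1) ≡⟨ cong (λ x → x + x) (∑-one n) ⟩
  2 ^ n + 2 ^ n              ≡⟨ m+m≡2*m (2 ^ n) ⟩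
  2 ^ suc n                  ∎
  where open ≡-Reasoning

∑-*ʳ : ∀ n (f : Vec Bool n → ℕ) k → ∑ n (λ v → f v * k) ≡ ∑ n f * k
∑-*ʳ n f k = sym (∑-homo +-0-isCommutativeMonoid +-0-isCommutativeMonoid (_* k) (*-distribʳ-+ k) n f)

ℤ∑-*ʳ : ∀ n (f : Vec Bool n → ℤ) c → ℤ∑.∑ n (λ v → f v ℤ.* c) ≡ ℤ∑.∑ n f ℤ.* c
ℤ∑-*ʳ n f c =
  sym (∑-homo ℤₚ.+-0-isCommutativeMonoid ℤₚ.+-0-isCommutativeMonoid (ℤ._* c) (ℤₚ.*-distribʳ-+ c) n f)

ℤ∑-*ˡ : ∀ n (f : Vec Bool n → ℤ) c → ℤ∑.∑ n (λ v → c ℤ.* f v) ≡ c ℤ.* ℤ∑.∑ n f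
ℤ∑-*ˡ n f c =
  sym (∑-homo ℤₚ.+-0-isCommutativeMonoid ℤₚ.+-0-isCommutativeMonoid (c ℤ.*_) (ℤₚ.*-distribˡ-+ c) n f)

ℤ∑-neg : ∀ n (f : Vec Bool n → ℤ) → ℤ∑.∑ n (λ v → - f v) ≡ - ℤ∑.∑ n f
ℤ∑-neg n f =
  sym (∑-homo ℤₚ.+-0-isCommutativeMonoid ℤₚ.+-0-isCommutativeMonoid -_ ℤₚ.neg-distrib-+ n f)

ℤ∑-+ : ∀ n (f : Vec Bool n → ℕ) → ℤ∑.∑ n (λ v → + f v) ≡ + ∑ n f
ℤ∑-+ n f = sym (∑-homo +-0-isCommutativeMonoid ℤₚ.+-0-isCommutativeMonoid +_ ℤₚ.pos-+ n f)

∑-mono-≤ : ∀ n {f g : Vec Bool n → ℕ} → (∀ v → f v ≤ g v) → ∑ n f ≤ ∑ n g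
∑-mono-≤ zero    f≤g = f≤g []
∑-mono-≤ (suc n) f≤g = ∑-mono-≤ n (λ v → +-mono-≤ (f≤g (false ∷ v)) (f≤g (true ∷ v)))

𝟙-split : ∀ p f → 𝟙 p ≡ 𝟙 (p ∧ f) + 𝟙 (p ∧ not f)
𝟙-split false f     = refl
𝟙-split true  false = refl
𝟙-split true  true  = refl

∑-𝟙-false : ∀ n (p : Vec Bool n → Bool) → (∀ v → p v ≡ false) → ∑ n (λ v → 𝟙 (p v)) ≡ 0
∑-𝟙-false n p none = trans (∑-cong n (λ v → cong 𝟙 (none v))) (∑-ε n)

length-filter-allVecs : ∀ n (p : Vec Bool n → Bool) →
                        length (filter (λ v → p v Bool.≟ true) (allVecs n)) ≡ ∑ n (λ v → 𝟙 (p v))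
length-filter-allVecs n p = trans (length-filter (allVecs n)) (foldr-allVecs n (λ v → 𝟙 (p v)))
  where
  length-filter : ∀ vs → length (filter (λ v → p v Bool.≟ true) vs) ≡ sum (map (λ v → 𝟙 (p v)) vs)
  length-filter []       = refl
  length-filter (v ∷ vs) with p v
  ... | true  = cong suc (length-filter vs)
  ... | false = length-filter vs

⋀-elim : ∀ n (p : Vec Bool n → Bool) → ⋀ n p ≡ true → ∀ v → p v ≡ true
⋀-elim zero    p all []          = all
⋀-elim (suc n) p all (false ∷ v) with p (false ∷ v) | ⋀-elim n _ all v
... | true | _ = refl
⋀-elim (suc n) p all (true ∷ v) with p (true ∷ v) | ⋀-elim n _ all v
... | true  | _  = refl
... | false | pv = trans (sym (∧-zeroʳ _)) pv

⋀-intro : ∀ n (p : Vec Bool n → Bool) → (∀ v → p v ≡ true) → ⋀ n p ≡ true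
⋀-intro zero    p all = all []
⋀-intro (suc n) p all = ⋀-intro n _ (λ v → cong₂ _∧_ (all (false ∷ v)) (all (true ∷ v)))

⋁-intro : ∀ n (p : Vec Bool n → Bool) v → p v ≡ true → ⋁ n p ≡ true
⋁-intro zero    p []          pv = pv
⋁-intro (suc n) p (false ∷ v) pv = ⋁-intro n _ v (cong (_∨ p (true ∷ v)) pv)
⋁-intro (suc n) p (true  ∷ v) pv =
  ⋁-intro n _ v (trans (cong (p (false ∷ v) ∨_) pv) (∨-zeroʳ (p (false ∷ v))))

⋁-elim : ∀ n (p : Vec Bool n → Bool) → ⋁ n p ≡ true → Σ[ v ∈ Vec Bool n ] p v ≡ true
⋁-elim zero    p any = [] , any
⋁-elim (suc n) p any with ⋁-elim n _ any
... | v , pv with p (false ∷ v) in p₀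
...   | true  = false ∷ v , p₀
...   | false = true ∷ v , pv

witness-or-none : ∀ n (p : Vec Bool n → Bool) →
                  (Σ[ v ∈ Vec Bool n ] p v ≡ true) ⊎ (∀ v → p v ≡ false)
witness-or-none n p with ⋁ n p in any
... | true  = inj₁ (⋁-elim n p any)
... | false = inj₂ none
  where
  none : ∀ v → p v ≡ false
  none v with p v in pv
  ... | true  = trans (sym (⋁-intro n p v pv)) any
  ... | false = refl

⨆-upper : ∀ n (f : Vec Bool n → ℕ) v → f v ≤ ⨆ n f
⨆-upper zero    f []          = ≤-refl
⨆-upper (suc n) f (false ∷ v) = ≤-trans (m≤m⊔n _ _) (⨆-upper n _ v)
⨆-upper (suc n) f (true  ∷ v) = ≤-trans (m≤n⊔m _ _) (⨆-upper n _ v)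

⨆-attained : ∀ n (f : Vec Bool n → ℕ) → Σ[ v ∈ Vec Bool n ] ⨆ n f ≡ f v
⨆-attained zero    f = [] , refl
⨆-attained (suc n) f with ⨆-attained n (λ v → f (false ∷ v) ⊔ f (true ∷ v))
... | v , max≡ with ⊔-sel (f (false ∷ v)) (f (true ∷ v))
...   | inj₁ sel = false ∷ v , trans max≡ sel
...   | inj₂ sel = true ∷ v , trans max≡ sel

∑-𝟙-isZero-⊕ : ∀ n (w : Vec Bool n) → ∑ n (λ v → 𝟙 (isZero (w ⊕ v))) ≡ 1
∑-𝟙-isZero-⊕ zero    []          = refl
∑-𝟙-isZero-⊕ (suc n) (false ∷ w) = trans (∑-cong n (λ v → +-identityʳ _)) (∑-𝟙-isZero-⊕ n w)
∑-𝟙-isZero-⊕ (suc n) (true  ∷ w) = ∑-𝟙-isZero-⊕ n w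

∑-𝟙-unique : ∀ n (p : Vec Bool n → Bool) → (∀ u v → p u ≡ true → p v ≡ true → u ≡ v) →
             ∑ n (λ v → 𝟙 (p v)) ≤ 1
∑-𝟙-unique n p unique with witness-or-none n p
... | inj₂ none       = ≤-trans (≤-reflexive (∑-𝟙-false n p none)) z≤n
... | inj₁ (w , pw) = ≤-trans (∑-mono-≤ n below) (≤-reflexive (∑-𝟙-isZero-⊕ n w))
  where
  below : ∀ v → 𝟙 (p v) ≤ 𝟙 (isZero (w ⊕ v))
  below v with p v in pv
  ... | false = z≤n
  ... | true rewrite unique w v pw pv | isZero-⊕-self v = ≤-refl

sum-applyUpTo-zero : ∀ n (f : ℕ → ℕ) → (∀ j → f j ≡ 0) → sum (List.applyUpTo f n) ≡ 0
sum-applyUpTo-zero zero    f f≡0 = refl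
sum-applyUpTo-zero (suc n) f f≡0 =
  cong₂ _+_ (f≡0 0) (sum-applyUpTo-zero n (λ j → f (suc j)) (λ j → f≡0 (suc j)))

sum-applyUpTo-single : ∀ n (f : ℕ → ℕ) a → a < n → (∀ j → j ≢ a → f j ≡ 0) →
                       sum (List.applyUpTo f n) ≡ f a
sum-applyUpTo-single (suc n) f zero    _   off =
  trans (cong (_+_ (f 0)) (sum-applyUpTo-zero n (λ j → f (suc j)) (λ j → off (suc j) (λ ()))))
        (+-identityʳ (f 0))
sum-applyUpTo-single (suc n) f (suc a) a<n off =
  trans (cong (_+ sum (List.applyUpTo (λ j → f (suc j)) n)) (off 0 (λ ())))
        (sum-applyUpTo-single n (λ j → f (suc j)) a (≤-pred a<n)
                              (λ j j≢a → off (suc j) (λ eq → j≢a (suc-injective eq))))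

∑-sum-comm : ∀ n (F : Vec Bool n → ℕ → ℕ) js →
             ∑ n (λ α → sum (map (F α) js)) ≡ sum (map (λ j → ∑ n (λ α → F α j)) js)
∑-sum-comm n F []       = ∑-ε n
∑-sum-comm n F (j ∷ js) =
  trans (∑-distrib n _ _) (cong (_+_ (∑ n (λ α → F α j))) (∑-sum-comm n F js))

-- Kernel, span and rank of a matrix over 𝔽₂

module _ {n : ℕ} where
  open import Algebra.Properties.CommutativeSemigroup
    (commutativeSemigroup (⊕-isCommutativeMonoid {n})) using (interchange; x∙yz≈y∙xz)

  combo-⊕ : ∀ {m} (c d : Vec Bool m) (M : Matrix m n) → combo (c ⊕ d) M ≡ combo c M ⊕ combo d M
  combo-⊕ []          []          []      = sym (⊕-self 0ᵛ)
  combo-⊕ (false ∷ c) (false ∷ d) (r ∷ M) = combo-⊕ c d M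
  combo-⊕ (false ∷ c) (true  ∷ d) (r ∷ M) = trans (cong (r ⊕_) (combo-⊕ c d M)) (x∙yz≈y∙xz r _ _)
  combo-⊕ (true  ∷ c) (false ∷ d) (r ∷ M) = trans (cong (r ⊕_) (combo-⊕ c d M)) (sym (⊕-assoc r _ _))
  combo-⊕ (true  ∷ c) (true  ∷ d) (r ∷ M) = begin
    combo (c ⊕ d) M                         ≡⟨ combo-⊕ c d M ⟩
    combo c M ⊕ combo d M                   ≡⟨ sym (⊕-identityˡ _) ⟩
    0ᵛ ⊕ (combo c M ⊕ combo d M)            ≡⟨ cong (_⊕ (combo c M ⊕ combo d M)) (sym (⊕-self r)) ⟩
    (r ⊕ r) ⊕ (combo c M ⊕ combo d M)       ≡⟨ interchange r r _ _ ⟩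
    (r ⊕ combo c M) ⊕ (r ⊕ combo d M)       ∎
    where open ≡-Reasoning

combo-∷ʳ : ∀ {m n} (z : Vec Bool m) b (M : Matrix m n) r →
           combo (z ∷ʳ b) (M ∷ʳ r) ≡ (if b then combo z M ⊕ r else combo z M)
combo-∷ʳ []          true  []       r = trans (⊕-identityʳ r) (sym (⊕-identityˡ r))
combo-∷ʳ []          false []       r = refl
combo-∷ʳ (true  ∷ z) true  (r′ ∷ M) r =
  trans (cong (r′ ⊕_) (combo-∷ʳ z true M r)) (sym (⊕-assoc r′ _ r))
combo-∷ʳ (false ∷ z) true  (r′ ∷ M) r = combo-∷ʳ z true M r
combo-∷ʳ (true  ∷ z) false (r′ ∷ M) r = cong (r′ ⊕_) (combo-∷ʳ z false M r)
combo-∷ʳ (false ∷ z) false (r′ ∷ M) r = combo-∷ʳ z false M r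

kernelSize : ∀ {m n} → Matrix m n → ℕ
kernelSize {m} M = ∑ m (λ c → 𝟙 (isZero (combo c M)))

inSpan : ∀ {m n} → Matrix m n → Vec Bool n → Bool
inSpan {m} M v = ⋁ m (λ c → isZero (combo c M ⊕ v))

spanSize : ∀ {m n} → Matrix m n → ℕ
spanSize {n = n} M = ∑ n (λ v → 𝟙 (inSpan M v))

inSpan-combo : ∀ {m n} (M : Matrix m n) c → inSpan M (combo c M) ≡ true
inSpan-combo {m} M c = ⋁-intro m _ c (isZero-⊕-self (combo c M))

inSpan⇒combo : ∀ {m n} (M : Matrix m n) v → inSpan M v ≡ true → Σ[ c ∈ Vec Bool m ] combo c M ≡ v
inSpan⇒combo {m} M v inV with ⋁-elim m _ inV
... | c , z = c , isZero-⊕⇒≡ (combo c M) v z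

inSpan-⊕ : ∀ {m n} (M : Matrix m n) u w →
           inSpan M u ≡ true → inSpan M w ≡ true → inSpan M (u ⊕ w) ≡ true
inSpan-⊕ M u w inU inW with inSpan⇒combo M u inU | inSpan⇒combo M w inW
... | c , refl | d , refl = subst (λ x → inSpan M x ≡ true) (combo-⊕ c d M) (inSpan-combo M (c ⊕ d))

fibreSize-combo : ∀ {m n} (M : Matrix m n) c₀ →
                  ∑ m (λ c → 𝟙 (isZero (combo c M ⊕ combo c₀ M))) ≡ kernelSize M
fibreSize-combo {m} M c₀ =
  trans (sym (∑-translate m _ c₀)) (∑-cong m (λ c → cong (λ x → 𝟙 (isZero x)) (shift-back c)))
  where
  shift-back : ∀ c → combo (c ⊕ c₀) M ⊕ combo c₀ M ≡ combo c M
  shift-back c = trans (cong (_⊕ combo c₀ M) (combo-⊕ c c₀ M)) (⊕-cancelʳ _ _)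

fibreSize : ∀ {m n} (M : Matrix m n) v →
            ∑ m (λ c → 𝟙 (isZero (combo c M ⊕ v))) ≡ 𝟙 (inSpan M v) * kernelSize M
fibreSize {m} M v with inSpan M v in inV
... | true  with inSpan⇒combo M v inV
...   | c₀ , refl = trans (fibreSize-combo M c₀) (sym (+-identityʳ _))
fibreSize {m} M v | false = ∑-𝟙-false m _ outside
  where
  outside : ∀ c → isZero (combo c M ⊕ v) ≡ false
  outside c with isZero (combo c M ⊕ v) in z
  ... | false = refl
  ... | true  = trans (sym (⋁-intro m _ c z)) inV

spanSize*kernelSize : ∀ {m n} (M : Matrix m n) → spanSize M * kernelSize M ≡ 2 ^ m
spanSize*kernelSize {m} {n} M = begin
  spanSize M * kernelSize M                              ≡⟨ sym (∑-*ʳ n _ (kernelSize M)) ⟩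
  ∑ n (λ v → 𝟙 (inSpan M v) * kernelSize M)             ≡⟨ ∑-cong n (λ v → sym (fibreSize M v)) ⟩
  ∑ n (λ v → ∑ m (λ c → 𝟙 (isZero (combo c M ⊕ v))))   ≡⟨ ∑-comm n m _ ⟩
  ∑ m (λ c → ∑ n (λ v → 𝟙 (isZero (combo c M ⊕ v))))   ≡⟨ ∑-cong m (λ c → ∑-𝟙-isZero-⊕ n (combo c M)) ⟩
  ∑ m (λ _ → 1)                                          ≡⟨ ∑-one m ⟩
  2 ^ m                                                  ∎
  where open ≡-Reasoning

𝟙-mono : ∀ {a b} → (a ≡ true → b ≡ true) → 𝟙 a ≤ 𝟙 b
𝟙-mono {false} _   = z≤n
𝟙-mono {true}  a⇒b rewrite a⇒b refl = ≤-refl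

𝟙-≤-+ : ∀ {a b c} → (a ≡ true → b ≡ true ⊎ c ≡ true) → 𝟙 a ≤ 𝟙 b + 𝟙 c
𝟙-≤-+ {false} _ = z≤n
𝟙-≤-+ {true} {b} a⇒b∨c with a⇒b∨c refl
... | inj₁ refl = s≤s z≤n
... | inj₂ refl = m≤n+m 1 (𝟙 b)

inSpan-∷ : ∀ {m n} r (M : Matrix m n) v → inSpan (r ∷ M) v ≡ true →
           inSpan M v ≡ true ⊎ inSpan M (v ⊕ r) ≡ true
inSpan-∷ r M v inV with inSpan⇒combo (r ∷ M) v inV
... | false ∷ c , refl = inj₁ (inSpan-combo M c)
... | true  ∷ c , refl =
  inj₂ (subst (λ x → inSpan M x ≡ true) (sym (trans (cong (_⊕ r) (⊕-comm r _)) (⊕-cancelʳ _ r)))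
              (inSpan-combo M c))

spanSize-∷ : ∀ {m n} r (M : Matrix m n) → spanSize (r ∷ M) ≤ 2 * spanSize M
spanSize-∷ {n = n} r M = begin
  spanSize (r ∷ M)                                        ≤⟨ ∑-mono-≤ n (λ v → 𝟙-≤-+ (inSpan-∷ r M v)) ⟩
  ∑ n (λ v → 𝟙 (inSpan M v) + 𝟙 (inSpan M (v ⊕ r)))      ≡⟨ ∑-distrib n _ _ ⟩
  spanSize M + ∑ n (λ v → 𝟙 (inSpan M (v ⊕ r)))           ≡⟨ cong (λ x → spanSize M + x) (∑-translate n _ r) ⟩
  spanSize M + spanSize M                                 ≡⟨ m+m≡2*m (spanSize M) ⟩
  2 * spanSize M                                          ∎
  where open ≤-Reasoning

spanSize-∷-inSpan : ∀ {m n} r (M : Matrix m n) → inSpan M r ≡ true → spanSize (r ∷ M) ≤ spanSize M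
spanSize-∷-inSpan {n = n} r M inR = ∑-mono-≤ n (λ v → 𝟙-mono (inSpan-∷-inSpan v))
  where
  inSpan-∷-inSpan : ∀ v → inSpan (r ∷ M) v ≡ true → inSpan M v ≡ true
  inSpan-∷-inSpan v inV with inSpan-∷ r M v inV
  ... | inj₁ inV′ = inV′
  ... | inj₂ inV⊕r =
    subst (λ x → inSpan M x ≡ true) (⊕-cancelʳ v r) (inSpan-⊕ M (v ⊕ r) r inV⊕r inR)

Independent : ∀ {m n} → Matrix m n → Vec Bool m → Set
Independent {m} M S = ∀ c → subsetOf c S ≡ true → isZero (combo c M) ≡ true → isZero c ≡ true

allB-allVecs : ∀ m (p : Vec Bool m → Bool) → allB p (allVecs m) ≡ ⋀ m p
allB-allVecs m p = trans (sym (Listₚ.foldr-map _∧_ p true (allVecs m))) (foldr-∧-allVecs m p)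

independentRows⇒Independent : ∀ {m n} (M : Matrix m n) S →
                              independentRows M S ≡ true → Independent M S
independentRows⇒Independent {m} M S ind c c⊆S cM≡0
  with ⋀-elim m _ (trans (sym (allB-allVecs m _)) ind) c
... | noRelation rewrite c⊆S | cM≡0 with isZero c
...   | true  = refl
...   | false = noRelation

Independent⇒independentRows : ∀ {m n} (M : Matrix m n) S →
                              Independent M S → independentRows M S ≡ true
Independent⇒independentRows {m} M S ind = trans (allB-allVecs m _) (⋀-intro m _ noRelation)
  where
  noRelation : ∀ c → not (subsetOf c S ∧ not (isZero c) ∧ isZero (combo c M)) ≡ true
  noRelation c with subsetOf c S in c⊆S | isZero (combo c M) in cM≡0
  ... | false | _     = refl
  ... | true  | false rewrite ∧-zeroʳ (not (isZero c)) = refl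
  ... | true  | true  rewrite ind c c⊆S cM≡0 = refl

Independent-0ᵛ : ∀ {m n} (M : Matrix m n) → Independent M 0ᵛ
Independent-0ᵛ M c c⊆0 _ = subsetOf-0ᵛ c c⊆0
  where
  subsetOf-0ᵛ : ∀ {m} (c : Vec Bool m) → subsetOf c 0ᵛ ≡ true → isZero c ≡ true
  subsetOf-0ᵛ []          _   = refl
  subsetOf-0ᵛ (false ∷ c) c⊆0 = subsetOf-0ᵛ c c⊆0

subsetOf-⊕ : ∀ {m} (c d S : Vec Bool m) →
             subsetOf c S ≡ true → subsetOf d S ≡ true → subsetOf (c ⊕ d) S ≡ true
subsetOf-⊕ []          []          []          _   _   = refl
subsetOf-⊕ (false ∷ c) (false ∷ d) (s ∷ S)     c⊆S d⊆S = subsetOf-⊕ c d S c⊆S d⊆S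
subsetOf-⊕ (false ∷ c) (true  ∷ d) (true ∷ S)  c⊆S d⊆S = subsetOf-⊕ c d S c⊆S d⊆S
subsetOf-⊕ (true  ∷ c) (false ∷ d) (true ∷ S)  c⊆S d⊆S = subsetOf-⊕ c d S c⊆S d⊆S
subsetOf-⊕ (true  ∷ c) (true  ∷ d) (true ∷ S)  c⊆S d⊆S = subsetOf-⊕ c d S c⊆S d⊆S

∑-subsetOf : ∀ {m} (S : Vec Bool m) → ∑ m (λ c → 𝟙 (subsetOf c S)) ≡ 2 ^ count S
∑-subsetOf []                 = refl
∑-subsetOf {suc m} (true ∷ S) = begin
  ∑ m (λ c → 𝟙 (subsetOf c S) + 𝟙 (subsetOf c S))               ≡⟨ ∑-distrib m _ _ ⟩
  ∑ m (λ c → 𝟙 (subsetOf c S)) + ∑ m (λ c → 𝟙 (subsetOf c S))   ≡⟨ cong (λ x → x + x) (∑-subsetOf S) ⟩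
  2 ^ count S + 2 ^ count S                                     ≡⟨ m+m≡2*m (2 ^ count S) ⟩
  2 ^ count (true ∷ S)                                          ∎
  where open ≡-Reasoning
∑-subsetOf {suc m} (false ∷ S) =
  trans (∑-cong m (λ c → +-identityʳ (𝟙 (subsetOf c S)))) (∑-subsetOf S)

-- Distinct subsets of an independent set have distinct sums.
2^count≤spanSize : ∀ {m n} (M : Matrix m n) S → Independent M S → 2 ^ count S ≤ spanSize M
2^count≤spanSize {m} {n} M S ind = begin
  2 ^ count S                                    ≡⟨ sym (∑-subsetOf S) ⟩
  ∑ m (λ c → 𝟙 (subsetOf c S))                   ≡⟨ ∑-cong m (λ c → sym (∑-𝟙-∧ (subsetOf c S) (combo c M))) ⟩
  ∑ m (λ c → ∑ n (λ v → 𝟙 (preimage v c)))       ≡⟨ ∑-comm m n _ ⟩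
  ∑ n (λ v → ∑ m (λ c → 𝟙 (preimage v c)))       ≤⟨ ∑-mono-≤ n preimage≤1 ⟩
  spanSize M                                     ∎
  where
  open ≤-Reasoning
  preimage : Vec Bool n → Vec Bool m → Bool
  preimage v c = subsetOf c S ∧ isZero (combo c M ⊕ v)
  ∑-𝟙-∧ : ∀ b (w : Vec Bool n) → ∑ n (λ v → 𝟙 (b ∧ isZero (w ⊕ v))) ≡ 𝟙 b
  ∑-𝟙-∧ true  w = ∑-𝟙-isZero-⊕ n w
  ∑-𝟙-∧ false w = ∑-ε n
  unique : ∀ v c d → preimage v c ≡ true → preimage v d ≡ true → c ≡ d
  unique v c d c∈ d∈ = isZero-⊕⇒≡ c d (ind (c ⊕ d)
    (subsetOf-⊕ c d S (∧-conicalˡ _ _ c∈) (∧-conicalˡ _ _ d∈))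
    (subst (λ x → isZero x ≡ true)
      (sym (trans (combo-⊕ c d M) (cong₂ _⊕_ (isZero-⊕⇒≡ _ v (∧-conicalʳ _ _ c∈))
                                             (isZero-⊕⇒≡ _ v (∧-conicalʳ _ _ d∈)))))
      (isZero-⊕-self v)))
  preimage≤1 : ∀ v → ∑ m (λ c → 𝟙 (preimage v c)) ≤ 𝟙 (inSpan M v)
  preimage≤1 v with inSpan M v in inV
  ... | true  = ∑-𝟙-unique m (preimage v) (unique v)
  ... | false = ≤-trans (∑-mono-≤ m (λ c → 𝟙-mono (∧-conicalʳ _ _)))
                        (≤-reflexive (trans (fibreSize M v) (cong (λ b → 𝟙 b * kernelSize M) inV)))

greedyBasis : ∀ {m n} → Matrix m n → Vec Bool m
greedyBasis []      = []
greedyBasis (r ∷ M) = not (inSpan M r) ∷ greedyBasis M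

greedyBasis-independent : ∀ {m n} (M : Matrix m n) → Independent M (greedyBasis M)
greedyBasis-independent []      []          _   _ = refl
greedyBasis-independent (r ∷ M) (false ∷ c) c⊆S z = greedyBasis-independent M c c⊆S z
greedyBasis-independent (r ∷ M) (true  ∷ c) c⊆S z with inSpan M r in inR
... | false = ⊥-elim (false≢true (trans (sym inR)
                (subst (λ x → inSpan M x ≡ true) (sym (isZero-⊕⇒≡ r (combo c M) z))
                       (inSpan-combo M c))))
greedyBasis-independent (r ∷ M) (true ∷ c) () z | true

spanSize≤2^count-greedyBasis : ∀ {m n} (M : Matrix m n) → spanSize M ≤ 2 ^ count (greedyBasis M)
spanSize≤2^count-greedyBasis {n = n} [] = ≤-reflexive (∑-𝟙-isZero-⊕ n 0ᵛ)
spanSize≤2^count-greedyBasis (r ∷ M) with inSpan M r in inR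
... | true  = ≤-trans (spanSize-∷-inSpan r M inR) (spanSize≤2^count-greedyBasis M)
... | false = ≤-trans (spanSize-∷ r M) (*-monoʳ-≤ 2 (spanSize≤2^count-greedyBasis M))

sizeIfIndependent : ∀ {m n} → Matrix m n → Vec Bool m → ℕ
sizeIfIndependent M S = if independentRows M S then count S else 0

rank-as-⨆ : ∀ {m n} (M : Matrix m n) → rank M ≡ ⨆ m (sizeIfIndependent M)
rank-as-⨆ {m} M = trans (maxList-filter (allVecs m)) (foldr-⊔-allVecs m _)
  where
  maxList-filter : ∀ Ss → maxList (map count (filter (λ S → independentRows M S Bool.≟ true) Ss))
                          ≡ maxList (map (sizeIfIndependent M) Ss)
  maxList-filter []       = refl
  maxList-filter (S ∷ Ss) with independentRows M S
  ... | true  = cong (count S ⊔_) (maxList-filter Ss)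
  ... | false = maxList-filter Ss

count≤length : ∀ {m} (S : Vec Bool m) → count S ≤ m
count≤length []          = z≤n
count≤length (true  ∷ S) = s≤s (count≤length S)
count≤length (false ∷ S) = m≤n⇒m≤1+n (count≤length S)

rank≤rows : ∀ {m n} (M : Matrix m n) → rank M ≤ m
rank≤rows {m} M with ⨆-attained m (sizeIfIndependent M)
... | S , max≡ with independentRows M S
...   | true  = ≤-trans (≤-reflexive (trans (rank-as-⨆ M) max≡)) (count≤length S)
...   | false = ≤-trans (≤-reflexive (trans (rank-as-⨆ M) max≡)) z≤n

2^rank≡spanSize : ∀ {m n} (M : Matrix m n) → 2 ^ rank M ≡ spanSize M
2^rank≡spanSize {m} M = ≤-antisym 2^rank≤ ≤2^rank
  where
  2^rank≤ : 2 ^ rank M ≤ spanSize M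
  2^rank≤ with ⨆-attained m (sizeIfIndependent M)
  ... | S , max≡ with independentRows M S in indS
  ...   | true  = subst (λ r → 2 ^ r ≤ spanSize M) (sym (trans (rank-as-⨆ M) max≡))
                    (2^count≤spanSize M S (independentRows⇒Independent M S indS))
  ...   | false = subst (λ r → 2 ^ r ≤ spanSize M)
                        (sym (trans (rank-as-⨆ M) (trans max≡ (sym (count-0ᵛ m)))))
                    (2^count≤spanSize M 0ᵛ (Independent-0ᵛ M))
    where
    count-0ᵛ : ∀ m → count (0ᵛ {m}) ≡ 0
    count-0ᵛ zero    = refl
    count-0ᵛ (suc m) = count-0ᵛ m
  ≤2^rank : spanSize M ≤ 2 ^ rank M
  ≤2^rank = ≤-trans (spanSize≤2^count-greedyBasis M)
                    (^-monoʳ-≤ 2 (≤-trans count≤⨆ (≤-reflexive (sym (rank-as-⨆ M)))))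
    where
    count≤⨆ : count (greedyBasis M) ≤ ⨆ m (sizeIfIndependent M)
    count≤⨆ = subst (λ b → (if b then count (greedyBasis M) else 0) ≤ ⨆ m (sizeIfIndependent M))
                (Independent⇒independentRows M _ (greedyBasis-independent M))
                (⨆-upper m _ (greedyBasis M))

kernelSize*2^rank : ∀ {m n} (M : Matrix m n) → kernelSize M * 2 ^ rank M ≡ 2 ^ m
kernelSize*2^rank {m} M = begin
  kernelSize M * 2 ^ rank M    ≡⟨ *-comm (kernelSize M) _ ⟩
  2 ^ rank M * kernelSize M    ≡⟨ cong (_* kernelSize M) (2^rank≡spanSize M) ⟩
  spanSize M * kernelSize M    ≡⟨ spanSize*kernelSize M ⟩
  2 ^ m                        ∎
  where open ≡-Reasoning

2^-injective : ∀ {x y} → 2 ^ x ≡ 2 ^ y → x ≡ y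
2^-injective {x} {y} 2^x≡2^y with <-cmp x y
... | tri< x<y _ _ = ⊥-elim (<-irrefl 2^x≡2^y (^-monoʳ-< 2 (s≤s (s≤s z≤n)) x<y))
... | tri≈ _ x≡y _ = x≡y
... | tri> _ _ y<x = ⊥-elim (<-irrefl (sym 2^x≡2^y) (^-monoʳ-< 2 (s≤s (s≤s z≤n)) y<x))

kernelSize≢0 : ∀ {m n} (M : Matrix m n) → kernelSize M ≢ 0
kernelSize≢0 {m} M K≡0 =
  <⇒≢ (m^n>0 2 m) (trans (sym (cong (_* 2 ^ rank M) K≡0)) (kernelSize*2^rank M))

rank-unique : ∀ {m n} (M : Matrix m n) j → kernelSize M * 2 ^ j ≡ 2 ^ m → rank M ≡ j
rank-unique {m} M j K*2^j≡2^m =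
  2^-injective (*-cancelˡ-≡ _ _ (kernelSize M) {{ℕ.≢-nonZero (kernelSize≢0 M)}}
                             (trans (kernelSize*2^rank M) (sym K*2^j≡2^m)))

kernelSize≡2^[m∸rank] : ∀ {m n} (M : Matrix m n) → kernelSize M ≡ 2 ^ (m ∸ rank M)
kernelSize≡2^[m∸rank] {m} M = *-cancelʳ-≡ _ _ (2 ^ rank M) {{m^n≢0 2 (rank M)}} (begin
  kernelSize M * 2 ^ rank M        ≡⟨ kernelSize*2^rank M ⟩
  2 ^ m                            ≡⟨ cong (2 ^_) (sym (m∸n+n≡m (rank≤rows M))) ⟩
  2 ^ (m ∸ rank M + rank M)        ≡⟨ ^-distribˡ-+-* 2 (m ∸ rank M) (rank M) ⟩
  2 ^ (m ∸ rank M) * 2 ^ rank M    ∎)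
  where open ≡-Reasoning

-- Hankel matrices and the coefficients of t·C

shift : Seq → Seq
shift t i = t (suc i)

shiftBy : ℕ → Seq → Seq
shiftBy k t i = t (k + i)

firstRow : ∀ {b} → Seq → Vec Bool b
firstRow t = tabulate (λ j → t (toℕ j))

coefT⁻¹-polyAdd : ∀ t P Q → coefT⁻¹ t (polyAdd P Q) ≡ coefT⁻¹ t P xor coefT⁻¹ t Q
coefT⁻¹-polyAdd t []      Q       = refl
coefT⁻¹-polyAdd t (a ∷ P) []      = sym (xor-identityʳ _)
coefT⁻¹-polyAdd t (a ∷ P) (b ∷ Q) =
  trans (cong₂ _xor_ (∧-distribʳ-xor (t 0) a b) (coefT⁻¹-polyAdd (shift t) P Q))
        (xor-interchange (a ∧ t 0) (b ∧ t 0) _ _)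

lowCoeffsZero : ℕ → Seq → List Bool → Bool
lowCoeffsZero zero    t C = true
lowCoeffsZero (suc n) t C = not (coefT⁻¹ t C) ∧ lowCoeffsZero n (shift t) C

lowCoeffsZero-suc : ∀ n t C →
                    lowCoeffsZero (suc n) t C ≡ lowCoeffsZero n t C ∧ not (coefT⁻¹ (shiftBy n t) C)
lowCoeffsZero-suc zero    t C = ∧-identityʳ _
lowCoeffsZero-suc (suc n) t C =
  trans (cong (not (coefT⁻¹ t C) ∧_) (lowCoeffsZero-suc n (shift t) C))
        (sym (∧-assoc (not (coefT⁻¹ t C)) (lowCoeffsZero n (shift t) C) _))

combo-D-suc : ∀ {m} n (c : Vec Bool m) t →
              combo c (D m (suc n) t) ≡ coefT⁻¹ t (toList c) ∷ combo c (D m n (shift t))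
combo-D-suc n []          t = refl
combo-D-suc n (true  ∷ c) t rewrite combo-D-suc n c (shift t) = refl
combo-D-suc n (false ∷ c) t rewrite combo-D-suc n c (shift t) = refl

-- Row combination c of D_{m×n}(t) lists the coefficients of T⁻¹, …, T⁻ⁿ in t·C, C = Σ cᵢ Tⁱ.
isZero-combo-D : ∀ {m} n (c : Vec Bool m) t → isZero (combo c (D m n t)) ≡ lowCoeffsZero n t (toList c)
isZero-combo-D zero    c t with combo c (D _ zero t)
... | [] = refl
isZero-combo-D (suc n) c t rewrite combo-D-suc n c t =
  cong (not (coefT⁻¹ t (toList c)) ∧_) (isZero-combo-D n c (shift t))

D-∷ʳ : ∀ a b t → D (suc a) b t ≡ D a b t ∷ʳ firstRow (shiftBy a t)
D-∷ʳ zero    b t = refl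
D-∷ʳ (suc a) b t = cong (firstRow t ∷_) (D-∷ʳ a b (shift t))

D-cong : ∀ a b {t t′ : Seq} → (∀ i → suc i < a + b → t i ≡ t′ i) → D a b t ≡ D a b t′
D-cong a b agree = tabulate-cong (λ i → tabulate-cong (λ j → agree (toℕ i + toℕ j)
  (≤-trans (≤-reflexive (sym (+-suc (suc (toℕ i)) (toℕ j)))) (+-mono-≤ (toℕ<n i) (toℕ<n j)))))

-- The character sum g as a count of kernel vectors

dot : ∀ {n} → Seq → Vec Bool n → List Bool → Bool
dot t []      Q = false
dot t (a ∷ y) Q = (a ∧ coefT⁻¹ t Q) xor dot (shift t) y Q

coefT⁻¹-monic-* : ∀ {k} t (y : Vec Bool k) Q →
                  coefT⁻¹ t (polyMul (monic y) Q) ≡ dot t y Q xor coefT⁻¹ (shiftBy k t) Q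
coefT⁻¹-monic-* t []              Q = trans (coefT⁻¹-polyAdd t Q (false ∷ [])) (xor-identityʳ _)
coefT⁻¹-monic-* {suc k} t (a ∷ y) Q = begin
  coefT⁻¹ t (polyAdd (if a then Q else []) (false ∷ polyMul (monic y) Q))
    ≡⟨ coefT⁻¹-polyAdd t (if a then Q else []) _ ⟩
  coefT⁻¹ t (if a then Q else []) xor coefT⁻¹ (shift t) (polyMul (monic y) Q)
    ≡⟨ cong₂ _xor_ (coefT⁻¹-if a) (coefT⁻¹-monic-* (shift t) y Q) ⟩
  (a ∧ coefT⁻¹ t Q) xor (dot (shift t) y Q xor coefT⁻¹ (shiftBy k (shift t)) Q)
    ≡⟨ sym (xor-assoc (a ∧ coefT⁻¹ t Q) _ _) ⟩
  dot t (a ∷ y) Q xor coefT⁻¹ (shiftBy (suc k) t) Q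
    ∎
  where
  open ≡-Reasoning
  coefT⁻¹-if : ∀ a → coefT⁻¹ t (if a then Q else []) ≡ a ∧ coefT⁻¹ t Q
  coefT⁻¹-if true  = refl
  coefT⁻¹-if false = refl

sign : Bool → ℤ
sign b = if b then - (+ 1) else + 1

sign-xor : ∀ a b → sign (a xor b) ≡ sign a ℤ.* sign b
sign-xor true  true  = refl
sign-xor true  false = refl
sign-xor false b     = sym (ℤₚ.*-identityˡ (sign b))

-- Orthogonality of characters: ∑_y (-1)^⟨y,w⟩ = 2ⁿ·[w = 0].
∑-sign-dot : ∀ n t Q → ℤ∑.∑ n (λ y → sign (dot t y Q)) ≡ + (2 ^ n * 𝟙 (lowCoeffsZero n t Q))
∑-sign-dot zero    t Q = refl
∑-sign-dot (suc n) t Q with coefT⁻¹ t Q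
... | true  = trans (ℤ∑.∑-cong n (λ y → cancel (dot (shift t) y Q)))
                    (trans (ℤ∑.∑-ε n) (cong +_ (sym (*-zeroʳ (2 ^ suc n)))))
  where
  cancel : ∀ d → sign d ℤ.+ sign (not d) ≡ + 0
  cancel true  = refl
  cancel false = refl
... | false = begin
  ℤ∑.∑ n (λ y → sign (dot (shift t) y Q) ℤ.+ sign (dot (shift t) y Q))
    ≡⟨ ℤ∑.∑-distrib n _ _ ⟩
  ℤ∑.∑ n (λ y → sign (dot (shift t) y Q)) ℤ.+ ℤ∑.∑ n (λ y → sign (dot (shift t) y Q))
    ≡⟨ cong (λ x → x ℤ.+ x) (∑-sign-dot n (shift t) Q) ⟩
  + (2 ^ n * z) ℤ.+ + (2 ^ n * z)
    ≡⟨ sym (ℤₚ.pos-+ (2 ^ n * z) _) ⟩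
  + (2 ^ n * z + 2 ^ n * z)
    ≡⟨ cong +_ (sym (*-distribʳ-+ z (2 ^ n) _)) ⟩
  + ((2 ^ n + 2 ^ n) * z)
    ≡⟨ cong (λ x → + (x * z)) (m+m≡2*m (2 ^ n)) ⟩
  + (2 ^ suc n * z)
    ∎
  where
  open ≡-Reasoning
  z = 𝟙 (lowCoeffsZero n (shift t) Q)

monicKernelSize : ∀ {m n} → Matrix (suc m) n → ℕ
monicKernelSize {m} M = ∑ m (λ z → 𝟙 (isZero (combo (z ∷ʳ true) M)))

isZero-combo-D-monic : ∀ {m} n (z : Vec Bool m) t →
                       isZero (combo (z ∷ʳ true) (D (suc m) n t)) ≡ lowCoeffsZero n t (monic z)
isZero-combo-D-monic n z t =
  trans (isZero-combo-D n (z ∷ʳ true) t) (cong (lowCoeffsZero n t) (toList-∷ʳ true z))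

-- Summing E(tYZ) over Y gives 2^k or 0 according as the coefficients of T⁻¹, …, T⁻ᵏ in tZ vanish or not,
-- with the sign (-1)^(coefficient of T⁻ᵏ⁻¹).
∑-E-monic : ∀ s k t (z : Vec Bool s) →
            ℤ∑.∑ k (λ y → E t (polyMul (monic y) (monic z)))
            ≡ + (2 ^ k) ℤ.* (+ (2 * 𝟙 (isZero (combo (z ∷ʳ true) (D (suc s) (suc k) t))))
                             - + 𝟙 (isZero (combo (z ∷ʳ true) (D (suc s) k t))))
∑-E-monic s k t z = begin
  ℤ∑.∑ k (λ y → E t (polyMul (monic y) Z))
    ≡⟨ ℤ∑.∑-cong k (λ y → trans (cong sign (coefT⁻¹-monic-* t y Z)) (sign-xor (dot t y Z) φ)) ⟩
  ℤ∑.∑ k (λ y → sign (dot t y Z) ℤ.* sign φ)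
    ≡⟨ ℤ∑-*ʳ k _ (sign φ) ⟩
  ℤ∑.∑ k (λ y → sign (dot t y Z)) ℤ.* sign φ
    ≡⟨ cong (ℤ._* sign φ) (∑-sign-dot k t Z) ⟩
  + (2 ^ k * 𝟙 P) ℤ.* sign φ
    ≡⟨ weigh P φ ⟩
  + (2 ^ k) ℤ.* (+ (2 * 𝟙 (P ∧ not φ)) - + 𝟙 P)
    ≡⟨ sym (cong₂ (λ a b → + (2 ^ k) ℤ.* (+ (2 * 𝟙 a) - + 𝟙 b))
              (trans (isZero-combo-D-monic (suc k) z t) (lowCoeffsZero-suc k t Z)) (isZero-combo-D-monic k z t)) ⟩
  + (2 ^ k) ℤ.* (+ (2 * 𝟙 (isZero (combo (z ∷ʳ true) (D (suc s) (suc k) t))))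
                 - + 𝟙 (isZero (combo (z ∷ʳ true) (D (suc s) k t))))
    ∎
  where
  open ≡-Reasoning
  Z = monic z
  P = lowCoeffsZero k t Z
  φ = coefT⁻¹ (shiftBy k t) Z
  weigh : ∀ P φ → + (2 ^ k * 𝟙 P) ℤ.* sign φ ≡ + (2 ^ k) ℤ.* (+ (2 * 𝟙 (P ∧ not φ)) - + 𝟙 P)
  weigh false φ     = trans (cong (λ x → + x ℤ.* sign φ) (*-zeroʳ (2 ^ k))) (sym (ℤₚ.*-zeroʳ (+ (2 ^ k))))
  weigh true  false = trans (ℤₚ.*-identityʳ _)
                            (trans (cong +_ (*-identityʳ (2 ^ k))) (sym (ℤₚ.*-identityʳ (+ (2 ^ k)))))
  weigh true  true  = cong (λ x → + x ℤ.* - (+ 1)) (*-identityʳ (2 ^ k))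

g-as-kernelSizes : ∀ s k t →
                   g (suc s) (suc k) t ≡ + (2 ^ k) ℤ.* (+ (2 * monicKernelSize (D (suc s) (suc k) t))
                                                       - + monicKernelSize (D (suc s) k t))
g-as-kernelSizes s k t = begin
  g (suc s) (suc k) t
    ≡⟨ trans (ℤ∑.foldr-allVecs k _) (ℤ∑.∑-cong k (λ y → ℤ∑.foldr-allVecs s _)) ⟩
  ℤ∑.∑ k (λ y → ℤ∑.∑ s (λ z → E t (polyMul (monic y) (monic z))))
    ≡⟨ ℤ∑.∑-comm k s _ ⟩
  ℤ∑.∑ s (λ z → ℤ∑.∑ k (λ y → E t (polyMul (monic y) (monic z))))
    ≡⟨ ℤ∑.∑-cong s (∑-E-monic s k t) ⟩
  ℤ∑.∑ s (λ z → + (2 ^ k) ℤ.* (+ (2 * u z) - + v z))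
    ≡⟨ ℤ∑-*ˡ s _ (+ (2 ^ k)) ⟩
  + (2 ^ k) ℤ.* ℤ∑.∑ s (λ z → + (2 * u z) ℤ.+ - + v z)
    ≡⟨ cong (+ (2 ^ k) ℤ.*_) (ℤ∑.∑-distrib s _ _) ⟩
  + (2 ^ k) ℤ.* (ℤ∑.∑ s (λ z → + (2 * u z)) ℤ.+ ℤ∑.∑ s (λ z → - + v z))
    ≡⟨ cong (+ (2 ^ k) ℤ.*_) (cong₂ ℤ._+_ (ℤ∑-+ s _)
                                          (trans (ℤ∑-neg s _) (cong -_ (ℤ∑-+ s v)))) ⟩
  + (2 ^ k) ℤ.* (+ ∑ s (λ z → 2 * u z) - + ∑ s v)
    ≡⟨ cong (λ x → + (2 ^ k) ℤ.* (+ x - + ∑ s v))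
            (sym (∑-homo +-0-isCommutativeMonoid +-0-isCommutativeMonoid (2 *_) (*-distribˡ-+ 2) s u)) ⟩
  + (2 ^ k) ℤ.* (+ (2 * ∑ s u) - + ∑ s v)
    ∎
  where
  open ≡-Reasoning
  u v : Vec Bool s → ℕ
  u z = 𝟙 (isZero (combo (z ∷ʳ true) (D (suc s) (suc k) t)))
  v z = 𝟙 (isZero (combo (z ∷ʳ true) (D (suc s) k t)))

g-local : ∀ s k {t t′} → (∀ i → i < s + suc k → t i ≡ t′ i) →
          g (suc s) (suc k) t ≡ g (suc s) (suc k) t′
g-local s k {t} {t′} agree = begin
  g (suc s) (suc k) t
    ≡⟨ g-as-kernelSizes s k t ⟩
  + (2 ^ k) ℤ.* (+ (2 * monicKernelSize (D (suc s) (suc k) t)) - + monicKernelSize (D (suc s) k t))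
    ≡⟨ cong₂ (λ A B → + (2 ^ k) ℤ.* (+ (2 * monicKernelSize A) - + monicKernelSize B))
             (D-cong (suc s) (suc k) (λ i lt → agree i (≤-pred lt)))
             (D-cong (suc s) k (λ i lt → agree i (≤-trans (≤-pred lt) (+-monoʳ-≤ s (n≤1+n k))))) ⟩
  + (2 ^ k) ℤ.* (+ (2 * monicKernelSize (D (suc s) (suc k) t′)) - + monicKernelSize (D (suc s) k t′))
    ≡⟨ sym (g-as-kernelSizes s k t′) ⟩
  g (suc s) (suc k) t′
    ∎
  where open ≡-Reasoning

-- How the kernel grows when a row or a column is appended

kernelSize-∷ʳ : ∀ {m n} (M : Matrix m n) r →
                kernelSize (M ∷ʳ r) ≡ kernelSize M + monicKernelSize (M ∷ʳ r)
kernelSize-∷ʳ {m} M r =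
  trans (∑-last m (λ c → 𝟙 (isZero (combo c (M ∷ʳ r)))))
        (cong (_+ monicKernelSize (M ∷ʳ r))
              (∑-cong m (λ z → cong (λ x → 𝟙 (isZero x)) (combo-∷ʳ z false M r))))

monicKernelSize-∷ʳ : ∀ {m n} (M : Matrix m n) r →
                     monicKernelSize (M ∷ʳ r) ≡ 𝟙 (inSpan M r) * kernelSize M
monicKernelSize-∷ʳ {m} M r =
  trans (∑-cong m (λ z → cong (λ x → 𝟙 (isZero x)) (combo-∷ʳ z true M r))) (fibreSize M r)

kernelSize-D-suc-rows : ∀ s n t →
                        kernelSize (D (suc s) n t) ≡ kernelSize (D s n t) + monicKernelSize (D (suc s) n t)
kernelSize-D-suc-rows s n t = subst (λ M → kernelSize M ≡ kernelSize (D s n t) + monicKernelSize M)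
                                    (sym (D-∷ʳ s n t)) (kernelSize-∷ʳ (D s n t) _)

monicKernelSize-D : ∀ s n t → monicKernelSize (D (suc s) n t) ≡ 0
                              ⊎ monicKernelSize (D (suc s) n t) ≡ kernelSize (D s n t)
monicKernelSize-D s n t
  with trans (cong monicKernelSize (D-∷ʳ s n t)) (monicKernelSize-∷ʳ (D s n t) (firstRow (shiftBy s t)))
... | u≡ with inSpan (D s n t) (firstRow (shiftBy s t))
...   | false = inj₁ u≡
...   | true  = inj₂ (trans u≡ (+-identityʳ _))

-- A linear functional either vanishes on a subgroup or takes the value 1 on exactly half of it.
∑-𝟙-halves : ∀ m (P φ : Vec Bool m → Bool) →
             (∀ c₀ → P c₀ ≡ true → ∀ c → P (c ⊕ c₀) ≡ P c) → (∀ c d → φ (c ⊕ d) ≡ φ c xor φ d) →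
             ∑ m (λ c → 𝟙 (P c ∧ φ c)) ≡ 0
             ⊎ ∑ m (λ c → 𝟙 (P c ∧ φ c)) ≡ ∑ m (λ c → 𝟙 (P c ∧ not (φ c)))
∑-𝟙-halves m P φ closed linear with witness-or-none m (λ c → P c ∧ φ c)
... | inj₂ none         = inj₁ (∑-𝟙-false m _ none)
... | inj₁ (c₀ , Pφc₀) = inj₂ (trans (sym (∑-translate m _ c₀)) (∑-cong m (λ c → cong 𝟙 (cong₂ _∧_
        (closed c₀ (∧-conicalˡ _ _ Pφc₀) c)
        (φ-flips c)))))
  where
  φ-flips : ∀ c → φ (c ⊕ c₀) ≡ not (φ c)
  φ-flips c = trans (linear c c₀) (trans (cong (φ c xor_) (∧-conicalʳ _ _ Pφc₀))
                                         (trans (xor-comm (φ c) true) (true-xor (φ c))))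

coefT⁻¹-⊕ : ∀ {m} t (c d : Vec Bool m) →
            coefT⁻¹ t (toList (c ⊕ d)) ≡ coefT⁻¹ t (toList c) xor coefT⁻¹ t (toList d)
coefT⁻¹-⊕ t c d = trans (cong (coefT⁻¹ t) (toList-⊕ c d)) (coefT⁻¹-polyAdd t (toList c) (toList d))
  where
  toList-⊕ : ∀ {m} (c d : Vec Bool m) → toList (c ⊕ d) ≡ polyAdd (toList c) (toList d)
  toList-⊕ []      []      = refl
  toList-⊕ (a ∷ c) (b ∷ d) = cong ((a xor b) ∷_) (toList-⊕ c d)

isZero-combo-translate : ∀ {m n} (M : Matrix m n) c₀ → isZero (combo c₀ M) ≡ true →
                         ∀ c → isZero (combo (c ⊕ c₀) M) ≡ isZero (combo c M)
isZero-combo-translate M c₀ c₀∈ker c =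
  cong isZero (trans (combo-⊕ c c₀ M)
                     (trans (cong (combo c M ⊕_) (isZero⇒≡0ᵛ _ c₀∈ker)) (⊕-identityʳ _)))

kernelSize-D-suc-columns : ∀ m n t → kernelSize (D m (suc n) t) ≤ kernelSize (D m n t)
                                     × kernelSize (D m n t) ≤ 2 * kernelSize (D m (suc n) t)
kernelSize-D-suc-columns m n t = K′≤K , K≤2K′
  where
  P φ : Vec Bool m → Bool
  P c = isZero (combo c (D m n t))
  φ c = coefT⁻¹ (shiftBy n t) (toList c)
  A B : ℕ
  A = ∑ m (λ c → 𝟙 (P c ∧ not (φ c)))
  B = ∑ m (λ c → 𝟙 (P c ∧ φ c))
  K′≡A : kernelSize (D m (suc n) t) ≡ A
  K′≡A = ∑-cong m (λ c → cong 𝟙 (trans (isZero-combo-D (suc n) c t)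
           (trans (lowCoeffsZero-suc n t (toList c)) (cong (_∧ not (φ c)) (sym (isZero-combo-D n c t))))))
  K≡B+A : kernelSize (D m n t) ≡ B + A
  K≡B+A = trans (∑-cong m (λ c → 𝟙-split (P c) (φ c))) (∑-distrib m _ _)
  K′≤K : kernelSize (D m (suc n) t) ≤ kernelSize (D m n t)
  K′≤K = subst₂ _≤_ (sym K′≡A) (sym K≡B+A) (m≤n+m A B)
  K≤2K′ : kernelSize (D m n t) ≤ 2 * kernelSize (D m (suc n) t)
  K≤2K′ with ∑-𝟙-halves m P φ (isZero-combo-translate (D m n t)) (coefT⁻¹-⊕ (shiftBy n t))
  ... | inj₁ B≡0 = subst₂ _≤_ (sym (trans K≡B+A (cong (_+ A) B≡0))) (cong (2 *_) (sym K′≡A)) (m≤m+n A (A + 0))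
  ... | inj₂ B≡A =
    ≤-reflexive (trans K≡B+A (trans (cong (_+ A) B≡A) (trans (m+m≡2*m A) (cong (2 *_) (sym K′≡A)))))

monicKernelSize-D-suc-columns : ∀ s n t →
                                monicKernelSize (D (suc s) (suc n) t) ≤ monicKernelSize (D (suc s) n t)
monicKernelSize-D-suc-columns s n t = ∑-mono-≤ s (λ z → 𝟙-mono (λ z∈ker →
  trans (isZero-combo-D-monic n z t)
        (∧-conicalˡ _ _ (trans (sym (lowCoeffsZero-suc n t (monic z)))
                               (trans (sym (isZero-combo-D-monic (suc n) z t)) z∈ker)))))

RanksJump : (s k j : ℕ) → Seq → Set
RanksJump s k j t =
  rank (D (s ∸ 1) (k ∸ 1) t) ≡ j × rank (D s (k ∸ 1) t) ≡ j ×
  rank (D (s ∸ 1) k t) ≡ j × rank (D s k t) ≡ j + 1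

ranksJump? : (s k j : ℕ) → Seq → Bool
ranksJump? s k j t =
  (rank (D (s ∸ 1) (k ∸ 1) t) ≡ᵇ j) ∧ (rank (D s (k ∸ 1) t) ≡ᵇ j) ∧
  (rank (D (s ∸ 1) k t) ≡ᵇ j) ∧ (rank (D s k t) ≡ᵇ j + 1)

≡ᵇ-true⇒≡ : ∀ m n → (m ≡ᵇ n) ≡ true → m ≡ n
≡ᵇ-true⇒≡ m n eq = ≡ᵇ⇒≡ m n (subst T (sym eq) tt)

≡ᵇ-refl : ∀ n → (n ≡ᵇ n) ≡ true
≡ᵇ-refl zero    = refl
≡ᵇ-refl (suc n) = ≡ᵇ-refl n

≢⇒≡ᵇ-false : ∀ m n → m ≢ n → (m ≡ᵇ n) ≡ false
≢⇒≡ᵇ-false m n m≢n with m ≡ᵇ n in eq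
... | true  = ⊥-elim (m≢n (≡ᵇ-true⇒≡ m n eq))
... | false = refl

all≡ᵇ⇒ : ∀ a a′ b b′ c c′ d d′ → ((a ≡ᵇ a′) ∧ (b ≡ᵇ b′) ∧ (c ≡ᵇ c′) ∧ (d ≡ᵇ d′)) ≡ true →
         a ≡ a′ × b ≡ b′ × c ≡ c′ × d ≡ d′
all≡ᵇ⇒ a a′ b b′ c c′ d d′ all =
  ≡ᵇ-true⇒≡ a a′ (∧-conicalˡ _ _ all) , ≡ᵇ-true⇒≡ b b′ (∧-conicalˡ _ _ bcd) ,
  ≡ᵇ-true⇒≡ c c′ (∧-conicalˡ _ _ cd)  , ≡ᵇ-true⇒≡ d d′ (∧-conicalʳ _ _ cd)
  where
  bcd = ∧-conicalʳ (a ≡ᵇ a′) _ all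
  cd  = ∧-conicalʳ (b ≡ᵇ b′) _ bcd

⇒all≡ᵇ : ∀ a b c d → ((a ≡ᵇ a) ∧ (b ≡ᵇ b) ∧ (c ≡ᵇ c) ∧ (d ≡ᵇ d)) ≡ true
⇒all≡ᵇ a b c d rewrite ≡ᵇ-refl a | ≡ᵇ-refl b | ≡ᵇ-refl c | ≡ᵇ-refl d = refl

fourRanks?⇒ : ∀ s k j t → fourRanks? s k j t ≡ true → FourRanks s k j t
fourRanks?⇒ s k j t = all≡ᵇ⇒ _ j _ j _ j _ j

⇒fourRanks? : ∀ s k j t → FourRanks s k j t → fourRanks? s k j t ≡ true
⇒fourRanks? s k j t (ra , rb , rc , rd) rewrite ra | rb | rc | rd = ⇒all≡ᵇ j j j j

ranksJump?⇒ : ∀ s k j t → ranksJump? s k j t ≡ true → RanksJump s k j t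
ranksJump?⇒ s k j t = all≡ᵇ⇒ _ j _ j _ j _ (j + 1)

⇒ranksJump? : ∀ s k j t → RanksJump s k j t → ranksJump? s k j t ≡ true
⇒ranksJump? s k j t (ra , rb , rc , rd) rewrite ra | rb | rc | rd = ⇒all≡ᵇ j j j (j + 1)

fourRanks?-off : ∀ s k j t → rank (D s k t) ≢ j → fourRanks? (suc s) (suc k) j t ≡ false
fourRanks?-off s k j t r≢j rewrite ≢⇒≡ᵇ-false _ j r≢j = refl

ranksJump?-off : ∀ s k j t → rank (D s k t) ≢ j → ranksJump? (suc s) (suc k) j t ≡ false
ranksJump?-off s k j t r≢j rewrite ≢⇒≡ᵇ-false _ j r≢j = refl

fourRanks-ranksJump-disjoint : ∀ s k j t → FourRanks s k j t → RanksJump s k j t → ⊥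
fourRanks-ranksJump-disjoint s k j t (_ , _ , _ , rd) (_ , _ , _ , rd′) =
  <-irrefl (trans (sym rd) (trans rd′ (+-comm j 1))) (n<1+n j)

kernelSize*2^j : ∀ {m n} (M : Matrix m n) {j} → rank M ≡ j → kernelSize M * 2 ^ j ≡ 2 ^ m
kernelSize*2^j M refl = kernelSize*2^rank M

*2^-cancel : ∀ K K′ j {N} → K * 2 ^ j ≡ N → K′ * 2 ^ j ≡ N → K ≡ K′
*2^-cancel K K′ j eq eq′ = *-cancelʳ-≡ K K′ (2 ^ j) {{m^n≢0 2 j}} (trans eq (sym eq′))

2*-*2^ : ∀ K j m → K * 2 ^ j ≡ 2 ^ m → (2 * K) * 2 ^ j ≡ 2 ^ suc m
2*-*2^ K j m eq = trans (*-assoc 2 K (2 ^ j)) (cong (2 *_) eq)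

*2^suc : ∀ K j m → K * 2 ^ j ≡ 2 ^ m → K * 2 ^ suc j ≡ 2 ^ suc m
*2^suc K j m eq =
  trans (*-comm K (2 ^ suc j)) (trans (*-assoc 2 (2 ^ j) K) (cong (2 *_) (trans (*-comm (2 ^ j) K) eq)))

2^-between : ∀ {p q} → 2 ^ p ≤ 2 ^ q → 2 ^ q ≤ 2 * 2 ^ p → q ≡ p ⊎ q ≡ suc p
2^-between {p} {q} 2^p≤2^q 2^q≤2^p+1 with <-cmp q p
... | tri< q<p _ _ = ⊥-elim (<⇒≱ (^-monoʳ-< 2 (s≤s (s≤s z≤n)) q<p) 2^p≤2^q)
... | tri≈ _ q≡p _ = inj₁ q≡p
... | tri> _ _ p<q with m≤n⇒m<n∨m≡n p<q
...   | inj₂ p+1≡q = inj₂ (sym p+1≡q)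
...   | inj₁ p+1<q = ⊥-elim (<⇒≱ (^-monoʳ-< 2 (s≤s (s≤s z≤n)) p+1<q) 2^q≤2^p+1)

∸-exponent : ∀ s k j → suc s + suc k ∸ (j + 2) ≡ s + k ∸ j
∸-exponent s k j = trans (cong (suc s + suc k ∸_) (+-comm j 2)) (cong (_∸ suc j) (+-suc s k))

+2^ : ∀ n → (+ 2) ^ℤ n ≡ + (2 ^ n)
+2^ zero    = refl
+2^ (suc n) = trans (cong (λ x → + 2 ℤ.* x) (+2^ n)) (sym (ℤₚ.pos-* 2 (2 ^ n)))

neg-^-even : ∀ x q → (- x) ^ℤ (2 * q) ≡ x ^ℤ (2 * q)
neg-^-even x q = begin
  (- x) ^ℤ (2 * q)          ≡⟨ sym (ℤₚ.^-*-assoc (- x) 2 q) ⟩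
  ((- x) ^ℤ 2) ^ℤ q         ≡⟨ cong (_^ℤ q) square ⟩
  (x ^ℤ 2) ^ℤ q             ≡⟨ ℤₚ.^-*-assoc x 2 q ⟩
  x ^ℤ (2 * q)              ∎
  where
  open ≡-Reasoning
  square : (- x) ^ℤ 2 ≡ x ^ℤ 2
  square = begin
    (- x) ℤ.* ((- x) ℤ.* + 1)  ≡⟨ cong ((- x) ℤ.*_) (ℤₚ.*-identityʳ (- x)) ⟩
    (- x) ℤ.* (- x)            ≡⟨ sym (ℤₚ.neg-distribˡ-* x (- x)) ⟩
    - (x ℤ.* (- x))            ≡⟨ cong -_ (sym (ℤₚ.neg-distribʳ-* x x)) ⟩
    - - (x ℤ.* x)              ≡⟨ ℤₚ.neg-involutive (x ℤ.* x) ⟩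
    x ℤ.* x                    ≡⟨ cong (x ℤ.*_) (sym (ℤₚ.*-identityʳ x)) ⟩
    x ℤ.* (x ℤ.* + 1)          ∎

+[2m]-+m : ∀ m → + (2 * m) - + m ≡ + m
+[2m]-+m m = begin
  + (2 * m) - + m               ≡⟨ cong (λ x → + (m + x) - + m) (+-identityʳ m) ⟩
  (+ m ℤ.+ + m) - + m           ≡⟨ ℤₚ.+-assoc (+ m) (+ m) (- + m) ⟩
  + m ℤ.+ (+ m - + m)           ≡⟨ cong (λ x → + m ℤ.+ x) (ℤₚ.+-inverseʳ (+ m)) ⟩
  + m ℤ.+ + 0                   ≡⟨ ℤₚ.+-identityʳ (+ m) ⟩
  + m                           ∎
  where open ≡-Reasoning

-- The paper's D_{(s-1)×(k-1)}, D_{s×(k-1)}, D_{(s-1)×k}, D_{s×k} are here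
-- D s k, D (suc s) k, D s (suc k), D (suc s) (suc k).
module KernelProfile (s k : ℕ) (t : Seq) where

  W V X U u v a : ℕ
  W = kernelSize (D s k t)
  V = kernelSize (D (suc s) k t)
  X = kernelSize (D s (suc k) t)
  U = kernelSize (D (suc s) (suc k) t)
  u = monicKernelSize (D (suc s) (suc k) t)
  v = monicKernelSize (D (suc s) k t)
  a = rank (D s k t)

  private
    U≡X+u : U ≡ X + u
    U≡X+u = kernelSize-D-suc-rows s (suc k) t

    V≡W+v : V ≡ W + v
    V≡W+v = kernelSize-D-suc-rows s k t

    X≢0 : X ≢ 0
    X≢0 = kernelSize≢0 (D s (suc k) t)

    X≡2^ : X ≡ 2 ^ (s ∸ rank (D s (suc k) t))
    X≡2^ = kernelSize≡2^[m∸rank] (D s (suc k) t)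

    W≡2^ : W ≡ 2 ^ (s ∸ a)
    W≡2^ = kernelSize≡2^[m∸rank] (D s k t)

    W*2^a : W * 2 ^ a ≡ 2 ^ s
    W*2^a = kernelSize*2^rank (D s k t)

    2^e^2q : ∀ {q} → ((+ 2) ^ℤ (suc s + suc k ∸ (a + 2))) ^ℤ (2 * q)
                     ≡ + (1 * 2 ^ ((suc s + suc k ∸ (a + 2)) * (2 * q)))
    2^e^2q {q} = trans (ℤₚ.^-*-assoc (+ 2) e (2 * q)) (trans (+2^ (e * (2 * q))) (cong +_ (sym (*-identityˡ _))))
      where e = suc s + suc k ∸ (a + 2)

    0^2q : ∀ q → 1 ≤ q → (+ 0) ^ℤ (2 * q) ≡ + 0
    0^2q (suc q) _ = refl

    u≡X⇒U≡2X : u ≡ X → U ≡ 2 * X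
    u≡X⇒U≡2X u≡X = trans U≡X+u (trans (cong (_+_ X) u≡X) (m+m≡2*m X))

    U≡2X⇒u≡X : U ≡ 2 * X → u ≡ X
    U≡2X⇒u≡X U≡2X = +-cancelˡ-≡ X u X (trans (sym U≡X+u) (trans U≡2X (sym (m+m≡2*m X))))

    u≡0⇒U≡X : u ≡ 0 → U ≡ X
    u≡0⇒U≡X u≡0 = trans U≡X+u (trans (cong (_+_ X) u≡0) (+-identityʳ X))

    U≡X⇒u≡0 : U ≡ X → u ≡ 0
    U≡X⇒u≡0 U≡X = +-cancelˡ-≡ X u 0 (trans (sym U≡X+u) (trans U≡X (sym (+-identityʳ X))))

    v≡W⇒V≡2W : v ≡ W → V ≡ 2 * W
    v≡W⇒V≡2W v≡W = trans V≡W+v (trans (cong (_+_ W) v≡W) (m+m≡2*m W))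

    V≡2W⇒v≡W : V ≡ 2 * W → v ≡ W
    V≡2W⇒v≡W V≡2W = +-cancelˡ-≡ W v W (trans (sym V≡W+v) (trans V≡2W (sym (m+m≡2*m W))))

  fourRanks⇒ : ∀ j → FourRanks (suc s) (suc k) j t → u ≡ X × v ≡ X
  fourRanks⇒ j (ra , rb , rc , rd) = U≡2X⇒u≡X U≡2X , trans (V≡2W⇒v≡W V≡2W) (sym X≡W)
    where
    hW = kernelSize*2^j (D s k t) ra
    hX = kernelSize*2^j (D s (suc k) t) rc
    X≡W = *2^-cancel X W j hX hW
    V≡2W = *2^-cancel V (2 * W) j (kernelSize*2^j (D (suc s) k t) rb) (2*-*2^ W j s hW)
    U≡2X = *2^-cancel U (2 * X) j (kernelSize*2^j (D (suc s) (suc k) t) rd) (2*-*2^ X j s hX)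

  ranksJump⇒ : ∀ j → RanksJump (suc s) (suc k) j t → u ≡ 0 × v ≡ X
  ranksJump⇒ j (ra , rb , rc , rd) = U≡X⇒u≡0 U≡X , trans (V≡2W⇒v≡W V≡2W) (sym X≡W)
    where
    hW = kernelSize*2^j (D s k t) ra
    hX = kernelSize*2^j (D s (suc k) t) rc
    X≡W = *2^-cancel X W j hX hW
    V≡2W = *2^-cancel V (2 * W) j (kernelSize*2^j (D (suc s) k t) rb) (2*-*2^ W j s hW)
    U≡X = *2^-cancel U X (suc j) (kernelSize*2^j (D (suc s) (suc k) t) (trans rd (+-comm j 1))) (*2^suc X j s hX)

  -- As X ≠ 0, v ≡ X forces v ≡ W rather than v ≡ 0.
  v≡X⇒ranks : v ≡ X → rank (D (suc s) k t) ≡ a × rank (D s (suc k) t) ≡ a × X * 2 ^ a ≡ 2 ^ s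
  v≡X⇒ranks v≡X with monicKernelSize-D s k t
  ... | inj₁ v≡0 = ⊥-elim (X≢0 (trans (sym v≡X) v≡0))
  ... | inj₂ v≡W = rank-unique (D (suc s) k t) a V*2^a , rank-unique (D s (suc k) t) a X*2^a , X*2^a
    where
    X*2^a = subst (λ K → K * 2 ^ a ≡ 2 ^ s) (trans (sym v≡W) v≡X) W*2^a
    V*2^a = subst (λ K → K * 2 ^ a ≡ 2 ^ suc s) (sym (v≡W⇒V≡2W v≡W)) (2*-*2^ W a s W*2^a)

  ⇒fourRanks : u ≡ X → v ≡ X → FourRanks (suc s) (suc k) a t
  ⇒fourRanks u≡X v≡X with v≡X⇒ranks v≡X
  ... | rb , rc , X*2^a = refl , rb , rc , rank-unique (D (suc s) (suc k) t) a
          (subst (λ K → K * 2 ^ a ≡ 2 ^ suc s) (sym (u≡X⇒U≡2X u≡X)) (2*-*2^ X a s X*2^a))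

  ⇒ranksJump : u ≡ 0 → v ≡ X → RanksJump (suc s) (suc k) a t
  ⇒ranksJump u≡0 v≡X with v≡X⇒ranks v≡X
  ... | rb , rc , X*2^a = refl , rb , rc , trans (rank-unique (D (suc s) (suc k) t) (suc a)
          (subst (λ K → K * 2 ^ suc a ≡ 2 ^ suc s) (sym (u≡0⇒U≡X u≡0)) (*2^suc X a s X*2^a)))
          (+-comm 1 a)

  W≡X⊎W≡2X : W ≡ X ⊎ W ≡ 2 * X
  W≡X⊎W≡2X with 2^-between {s ∸ rank (D s (suc k) t)} {s ∸ a}
                  (subst₂ _≤_ X≡2^ W≡2^ (proj₁ (kernelSize-D-suc-columns s k t)))
                  (subst₂ _≤_ W≡2^ (cong (2 *_) X≡2^) (proj₂ (kernelSize-D-suc-columns s k t)))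
  ... | inj₁ q≡p   = inj₁ (trans W≡2^ (trans (cong (2 ^_) q≡p) (sym X≡2^)))
  ... | inj₂ q≡p+1 = inj₂ (trans W≡2^ (trans (cong (2 ^_) q≡p+1) (cong (2 *_) (sym X≡2^))))

  trichotomy : 2 * u ≡ v ⊎ (u ≡ X × v ≡ X) ⊎ (u ≡ 0 × v ≡ X)
  trichotomy with monicKernelSize-D s (suc k) t | monicKernelSize-D s k t
  ... | inj₁ u≡0 | inj₁ v≡0 = inj₁ (trans (cong (2 *_) u≡0) (sym v≡0))
  ... | inj₂ u≡X | inj₁ v≡0 =
    ⊥-elim (X≢0 (n≤0⇒n≡0 (subst₂ _≤_ u≡X v≡0 (monicKernelSize-D-suc-columns s k t))))
  ... | inj₂ u≡X | inj₂ v≡W with W≡X⊎W≡2X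
  ...   | inj₁ W≡X  = inj₂ (inj₁ (u≡X , trans v≡W W≡X))
  ...   | inj₂ W≡2X = inj₁ (trans (cong (2 *_) u≡X) (trans (sym W≡2X) (sym v≡W)))
  trichotomy | inj₁ u≡0 | inj₂ v≡W = inj₂ (inj₂ (u≡0 , trans v≡W W≡X))
    where
    W≤X = *-cancelˡ-≤ 2 (subst₂ _≤_ (v≡W⇒V≡2W v≡W) (cong (2 *_) (u≡0⇒U≡X u≡0))
                                   (proj₂ (kernelSize-D-suc-columns (suc s) k t)))
    W≡X = ≤-antisym W≤X (proj₁ (kernelSize-D-suc-columns s k t))

  2^k*X : ∀ j → rank (D s (suc k) t) ≡ j → + (2 ^ k) ℤ.* + X ≡ (+ 2) ^ℤ (suc s + suc k ∸ (j + 2))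
  2^k*X j rc = begin
    + (2 ^ k) ℤ.* + X                    ≡⟨ sym (ℤₚ.pos-* (2 ^ k) X) ⟩
    + (2 ^ k * X)                        ≡⟨ cong (λ x → + (2 ^ k * x)) X≡2^ ⟩
    + (2 ^ k * 2 ^ (s ∸ rank (D s (suc k) t)))  ≡⟨ cong (λ r → + (2 ^ k * 2 ^ (s ∸ r))) rc ⟩
    + (2 ^ k * 2 ^ (s ∸ j))              ≡⟨ cong +_ (sym (^-distribˡ-+-* 2 k (s ∸ j))) ⟩
    + (2 ^ (k + (s ∸ j)))                ≡⟨ sym (+2^ (k + (s ∸ j))) ⟩
    (+ 2) ^ℤ (k + (s ∸ j))               ≡⟨ cong ((+ 2) ^ℤ_) (sym exponent) ⟩
    (+ 2) ^ℤ (suc s + suc k ∸ (j + 2))   ∎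
    where
    open ≡-Reasoning
    exponent : suc s + suc k ∸ (j + 2) ≡ k + (s ∸ j)
    exponent = begin
      suc s + suc k ∸ (j + 2)  ≡⟨ ∸-exponent s k j ⟩
      s + k ∸ j                ≡⟨ +-∸-comm k (subst (_≤ s) rc (rank≤rows (D s (suc k) t))) ⟩
      s ∸ j + k                ≡⟨ +-comm (s ∸ j) k ⟩
      k + (s ∸ j)              ∎

  g≡ : g (suc s) (suc k) t ≡ + (2 ^ k) ℤ.* (+ (2 * u) - + v)
  g≡ = g-as-kernelSizes s k t

  g-fourRanks : ∀ j → FourRanks (suc s) (suc k) j t →
                g (suc s) (suc k) t ≡ (+ 2) ^ℤ (suc s + suc k ∸ (j + 2))
  g-fourRanks j four with fourRanks⇒ j four
  ... | u≡X , v≡X = begin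
    g (suc s) (suc k) t                       ≡⟨ g≡ ⟩
    + (2 ^ k) ℤ.* (+ (2 * u) - + v)           ≡⟨ cong₂ (λ x y → + (2 ^ k) ℤ.* (+ (2 * x) - + y)) u≡X v≡X ⟩
    + (2 ^ k) ℤ.* (+ (2 * X) - + X)           ≡⟨ cong (λ x → + (2 ^ k) ℤ.* x) (+[2m]-+m X) ⟩
    + (2 ^ k) ℤ.* + X                         ≡⟨ 2^k*X j (proj₁ (proj₂ (proj₂ four))) ⟩
    (+ 2) ^ℤ (suc s + suc k ∸ (j + 2))        ∎
    where open ≡-Reasoning

  g-ranksJump : ∀ j → RanksJump (suc s) (suc k) j t →
                g (suc s) (suc k) t ≡ - ((+ 2) ^ℤ (suc s + suc k ∸ (j + 2)))
  g-ranksJump j jump with ranksJump⇒ j jump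
  ... | u≡0 , v≡X = begin
    g (suc s) (suc k) t                       ≡⟨ g≡ ⟩
    + (2 ^ k) ℤ.* (+ (2 * u) - + v)           ≡⟨ cong₂ (λ x y → + (2 ^ k) ℤ.* (+ (2 * x) - + y)) u≡0 v≡X ⟩
    + (2 ^ k) ℤ.* (+ 0 - + X)                 ≡⟨ cong (λ x → + (2 ^ k) ℤ.* x) (ℤₚ.+-identityˡ (- + X)) ⟩
    + (2 ^ k) ℤ.* - + X                       ≡⟨ sym (ℤₚ.neg-distribʳ-* (+ (2 ^ k)) (+ X)) ⟩
    - (+ (2 ^ k) ℤ.* + X)                     ≡⟨ cong -_ (2^k*X j (proj₁ (proj₂ (proj₂ jump)))) ⟩
    - ((+ 2) ^ℤ (suc s + suc k ∸ (j + 2)))    ∎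
    where open ≡-Reasoning

  g-vanishes-at-rank : ¬ FourRanks (suc s) (suc k) a t → ¬ RanksJump (suc s) (suc k) a t →
                       g (suc s) (suc k) t ≡ + 0
  g-vanishes-at-rank ¬four ¬jump with trichotomy
  ... | inj₁ 2u≡v = begin
    g (suc s) (suc k) t                       ≡⟨ g≡ ⟩
    + (2 ^ k) ℤ.* (+ (2 * u) - + v)           ≡⟨ cong (λ x → + (2 ^ k) ℤ.* (+ x - + v)) 2u≡v ⟩
    + (2 ^ k) ℤ.* (+ v - + v)                 ≡⟨ cong (λ x → + (2 ^ k) ℤ.* x) (ℤₚ.+-inverseʳ (+ v)) ⟩
    + (2 ^ k) ℤ.* + 0                         ≡⟨ ℤₚ.*-zeroʳ (+ (2 ^ k)) ⟩
    + 0                                       ∎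
    where open ≡-Reasoning
  ... | inj₂ (inj₁ (u≡X , v≡X)) = ⊥-elim (¬four (⇒fourRanks u≡X v≡X))
  ... | inj₂ (inj₂ (u≡0 , v≡X)) = ⊥-elim (¬jump (⇒ranksJump u≡0 v≡X))

  g-vanishes : (∀ j → ¬ FourRanks (suc s) (suc k) j t × ¬ RanksJump (suc s) (suc k) j t) →
               g (suc s) (suc k) t ≡ + 0
  g-vanishes neither = g-vanishes-at-rank (proj₁ (neither a)) (proj₂ (neither a))

  g^2q : ∀ q → 1 ≤ q →
         g (suc s) (suc k) t ^ℤ (2 * q)
         ≡ + ((𝟙 (fourRanks? (suc s) (suc k) a t) + 𝟙 (ranksJump? (suc s) (suc k) a t))
              * 2 ^ ((suc s + suc k ∸ (a + 2)) * (2 * q)))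
  g^2q q q≥1 with fourRanks? (suc s) (suc k) a t in four | ranksJump? (suc s) (suc k) a t in jump
  ... | true  | false = trans (cong (_^ℤ (2 * q)) (g-fourRanks a (fourRanks?⇒ (suc s) (suc k) a t four)))
                              (2^e^2q {q})
  ... | false | true  = trans (cong (_^ℤ (2 * q)) (g-ranksJump a (ranksJump?⇒ (suc s) (suc k) a t jump)))
                              (trans (neg-^-even _ q) (2^e^2q {q}))
  ... | true  | true  = ⊥-elim (fourRanks-ranksJump-disjoint (suc s) (suc k) a t
                                  (fourRanks?⇒ (suc s) (suc k) a t four) (ranksJump?⇒ (suc s) (suc k) a t jump))
  ... | false | false = trans (cong (_^ℤ (2 * q)) (g-vanishes-at-rank
                          (λ F → false≢true (trans (sym four) (⇒fourRanks? (suc s) (suc k) a t F)))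
                          (λ J → false≢true (trans (sym jump) (⇒ranksJump? (suc s) (suc k) a t J)))))
                          (0^2q q q≥1)

coefT⁻¹-monic-flip : ∀ {m} (z : Vec Bool m) {t t′} → (∀ i → i < m → t i ≡ t′ i) → t′ m ≡ not (t m) →
                     coefT⁻¹ t′ (monic z) ≡ not (coefT⁻¹ t (monic z))
coefT⁻¹-monic-flip []      {t} {t′} agree flipped =
  trans (xor-identityʳ (t′ 0)) (trans flipped (cong not (sym (xor-identityʳ (t 0)))))
coefT⁻¹-monic-flip (a ∷ z) {t} {t′} agree flipped = begin
  (a ∧ t′ 0) xor coefT⁻¹ (shift t′) (monic z)
    ≡⟨ cong₂ (λ x y → (a ∧ x) xor y) (sym (agree 0 (s≤s z≤n)))
                                      (coefT⁻¹-monic-flip z (λ i lt → agree (suc i) (s≤s lt)) flipped) ⟩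
  (a ∧ t 0) xor not (coefT⁻¹ (shift t) (monic z))
    ≡⟨ sym (not-distribʳ-xor (a ∧ t 0) _) ⟩
  not ((a ∧ t 0) xor coefT⁻¹ (shift t) (monic z))
    ∎
  where open ≡-Reasoning

-- α_{s+k+1} enters D_{(s+1)×(k+1)} only in its last entry; flipping it moves each monic kernel vector of
-- D_{(s+1)×k} into exactly one of the two kernels of D_{(s+1)×(k+1)}.
monicKernelSize-flip : ∀ s k {t t′} → (∀ i → i < s + k → t i ≡ t′ i) → t′ (s + k) ≡ not (t (s + k)) →
                       monicKernelSize (D (suc s) (suc k) t) + monicKernelSize (D (suc s) (suc k) t′)
                       ≡ monicKernelSize (D (suc s) k t)
monicKernelSize-flip s k {t} {t′} agree flipped =
  trans (sym (∑-distrib s _ _)) (∑-cong s (λ z → begin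
    𝟙 (isZero (combo (z ∷ʳ true) (D (suc s) (suc k) t)))
    + 𝟙 (isZero (combo (z ∷ʳ true) (D (suc s) (suc k) t′)))
      ≡⟨ cong₂ (λ x y → 𝟙 x + 𝟙 y) (isZero-suc t z) (isZero-suc t′ z) ⟩
    𝟙 (L t z ∧ not (φ t z)) + 𝟙 (L t′ z ∧ not (φ t′ z))
      ≡⟨ cong₂ (λ x y → 𝟙 (L t z ∧ not (φ t z)) + 𝟙 (x ∧ not y)) (L-same z) (φ-flipped z) ⟩
    𝟙 (L t z ∧ not (φ t z)) + 𝟙 (L t z ∧ not (not (φ t z)))
      ≡⟨ sym (𝟙-split (L t z) (not (φ t z))) ⟩
    𝟙 (L t z)
      ≡⟨ cong 𝟙 (sym (isZero-combo-D-monic k z t)) ⟩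
    𝟙 (isZero (combo (z ∷ʳ true) (D (suc s) k t)))
      ∎))
  where
  open ≡-Reasoning
  L : Seq → Vec Bool s → Bool
  L u z = lowCoeffsZero k u (monic z)
  φ : Seq → Vec Bool s → Bool
  φ u z = coefT⁻¹ (shiftBy k u) (monic z)
  isZero-suc : ∀ u z → isZero (combo (z ∷ʳ true) (D (suc s) (suc k) u)) ≡ L u z ∧ not (φ u z)
  isZero-suc u z = trans (isZero-combo-D-monic (suc k) z u) (lowCoeffsZero-suc k u (monic z))
  L-same : ∀ z → L t′ z ≡ L t z
  L-same z = trans (sym (isZero-combo-D-monic k z t′))
               (trans (cong (λ M → isZero (combo (z ∷ʳ true) M))
                            (sym (D-cong (suc s) k (λ i lt → agree i (≤-pred lt)))))
                      (isZero-combo-D-monic k z t))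
  φ-flipped : ∀ z → φ t′ z ≡ not (φ t z)
  φ-flipped z = coefT⁻¹-monic-flip z
    (λ i i<s → agree (k + i) (subst (k + i <_) (+-comm k s) (+-monoʳ-< k i<s)))
    (trans (cong t′ (+-comm k s)) (trans flipped (cong (λ i → not (t i)) (+-comm s k))))

module Flipped (s k : ℕ) {t t′ : Seq}
               (agree : ∀ i → i < s + k → t i ≡ t′ i) (flipped : t′ (s + k) ≡ not (t (s + k))) where

  private
    module P  = KernelProfile s k t
    module P′ = KernelProfile s k t′

    Dₛₖ : D s k t ≡ D s k t′
    Dₛₖ = D-cong s k (λ i lt → agree i (<-trans (n<1+n i) lt))
    Dₛ₊₁ₖ : D (suc s) k t ≡ D (suc s) k t′
    Dₛ₊₁ₖ = D-cong (suc s) k (λ i lt → agree i (≤-pred lt))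
    Dₛₖ₊₁ : D s (suc k) t ≡ D s (suc k) t′
    Dₛₖ₊₁ = D-cong s (suc k) (λ i lt → agree i (≤-pred (subst (suc i <_) (+-suc s k) lt)))

    X′≡X : P′.X ≡ P.X
    X′≡X = cong kernelSize (sym Dₛₖ₊₁)
    v′≡v : P′.v ≡ P.v
    v′≡v = cong monicKernelSize (sym Dₛ₊₁ₖ)
    u+u′≡v : P.u + P′.u ≡ P.v
    u+u′≡v = monicKernelSize-flip s k agree flipped

  fourRanks⇒ranksJump : ∀ j → FourRanks (suc s) (suc k) j t → RanksJump (suc s) (suc k) j t′
  fourRanks⇒ranksJump j four with P.fourRanks⇒ j four
  ... | u≡X , v≡X = subst (λ r → RanksJump (suc s) (suc k) r t′) (trans (cong rank (sym Dₛₖ)) (proj₁ four))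
                      (P′.⇒ranksJump u′≡0 (trans v′≡v (trans v≡X (sym X′≡X))))
    where
    u′≡0 : P′.u ≡ 0
    u′≡0 = +-cancelˡ-≡ P.X P′.u 0
             (trans (cong (_+ P′.u) (sym u≡X)) (trans u+u′≡v (trans v≡X (sym (+-identityʳ P.X)))))

  ranksJump⇒fourRanks : ∀ j → RanksJump (suc s) (suc k) j t′ → FourRanks (suc s) (suc k) j t
  ranksJump⇒fourRanks j jump with P′.ranksJump⇒ j jump
  ... | u′≡0 , v′≡X′ = subst (λ r → FourRanks (suc s) (suc k) r t) (trans (cong rank Dₛₖ) (proj₁ jump))
                         (P.⇒fourRanks u≡X v≡X)
    where
    v≡X : P.v ≡ P.X
    v≡X = trans (sym v′≡v) (trans v′≡X′ X′≡X)
    u≡X : P.u ≡ P.X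
    u≡X = trans (sym (trans (cong (_+_ P.u) u′≡0) (+-identityʳ P.u))) (trans u+u′≡v v≡X)

  ranksJump?≡fourRanks? : ∀ j → ranksJump? (suc s) (suc k) j t′ ≡ fourRanks? (suc s) (suc k) j t
  ranksJump?≡fourRanks? j with ranksJump? (suc s) (suc k) j t′ in jump | fourRanks? (suc s) (suc k) j t in four
  ... | true  | true  = refl
  ... | false | false = refl
  ... | true  | false = sym (trans (sym four) (⇒fourRanks? (suc s) (suc k) j t
                          (ranksJump⇒fourRanks j (ranksJump?⇒ (suc s) (suc k) j t′ jump))))
  ... | false | true  = trans (sym jump) (⇒ranksJump? (suc s) (suc k) j t′
                          (fourRanks⇒ranksJump j (fourRanks?⇒ (suc s) (suc k) j t four)))

∑-extend-dim : ∀ {m m′} → m ≡ m′ → (h : Seq → ℕ) →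
               ∑ m (λ α → h (extend α)) ≡ ∑ m′ (λ α → h (extend α))
∑-extend-dim refl h = refl

lastUnit : ∀ m → Vec Bool (suc m)
lastUnit m = 0ᵛ ∷ʳ true

extend-⊕-lastUnit-< : ∀ {m} (α : Vec Bool (suc m)) i → i < m → extend α i ≡ extend (α ⊕ lastUnit m) i
extend-⊕-lastUnit-< {suc m} (a ∷ α) zero    _   = sym (xor-identityʳ a)
extend-⊕-lastUnit-< {suc m} (a ∷ α) (suc i) i<m = extend-⊕-lastUnit-< α i (≤-pred i<m)

extend-⊕-lastUnit-≡ : ∀ {m} (α : Vec Bool (suc m)) → extend (α ⊕ lastUnit m) m ≡ not (extend α m)
extend-⊕-lastUnit-≡ {zero}  (a ∷ []) = trans (xor-comm a true) (true-xor a)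
extend-⊕-lastUnit-≡ {suc m} (a ∷ α)  = extend-⊕-lastUnit-≡ α

N-as-∑ : ∀ s k j →
         N (suc s) (suc k) j ≡ ∑ (s + suc k) (λ α → 𝟙 (fourRanks? (suc s) (suc k) j (extend α)))
N-as-∑ s k j = trans (length-filter-allVecs (k + suc s) _)
  (∑-extend-dim (trans (+-comm k (suc s)) (sym (+-suc s k))) (λ t → 𝟙 (fourRanks? (suc s) (suc k) j t)))

∑-ranksJump? : ∀ s k j →
               ∑ (s + suc k) (λ α → 𝟙 (ranksJump? (suc s) (suc k) j (extend α))) ≡ N (suc s) (suc k) j
∑-ranksJump? s k j = begin
  ∑ (s + suc k) (λ α → 𝟙 (ranksJump? (suc s) (suc k) j (extend α)))
    ≡⟨ ∑-extend-dim (+-suc s k) (λ t → 𝟙 (ranksJump? (suc s) (suc k) j t)) ⟩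
  ∑ (suc (s + k)) (λ α → 𝟙 (ranksJump? (suc s) (suc k) j (extend α)))
    ≡⟨ sym (∑-translate (suc (s + k)) (λ α → 𝟙 (ranksJump? (suc s) (suc k) j (extend α)))
                        (lastUnit (s + k))) ⟩
  ∑ (suc (s + k)) (λ α → 𝟙 (ranksJump? (suc s) (suc k) j (extend (α ⊕ lastUnit (s + k)))))
    ≡⟨ ∑-cong (suc (s + k)) (λ α → cong 𝟙
         (Flipped.ranksJump?≡fourRanks? s k (extend-⊕-lastUnit-< α) (extend-⊕-lastUnit-≡ α) j)) ⟩
  ∑ (suc (s + k)) (λ α → 𝟙 (fourRanks? (suc s) (suc k) j (extend α)))
    ≡⟨ ∑-extend-dim (sym (+-suc s k)) (λ t → 𝟙 (fourRanks? (suc s) (suc k) j t)) ⟩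
  ∑ (s + suc k) (λ α → 𝟙 (fourRanks? (suc s) (suc k) j (extend α)))
    ≡⟨ sym (N-as-∑ s k j) ⟩
  N (suc s) (suc k) j
    ∎
  where open ≡-Reasoning

toℚ-+ : ∀ a b → toℚ (a ℤ.+ b) ≡ toℚ a ℚ.+ toℚ b
toℚ-+ a b = ℚₚ.toℚᵘ-injective (begin
  ℚ.toℚᵘ (toℚ (a ℤ.+ b))
    ≈⟨ ℚₚ.toℚᵘ-fromℚᵘ (ℚᵘ.mkℚᵘ (a ℤ.+ b) 0) ⟩
  ℚᵘ.mkℚᵘ (a ℤ.+ b) 0
    ≈⟨ ℚᵘ.*≡* (cong₂ (λ x y → (x ℤ.+ y) ℤ.* + 1) (sym (ℤₚ.*-identityʳ a)) (sym (ℤₚ.*-identityʳ b))) ⟩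
  ℚᵘ.mkℚᵘ a 0 ℚᵘ.+ ℚᵘ.mkℚᵘ b 0
    ≈⟨ ℚᵘₚ.+-cong (ℚᵘₚ.≃-sym (ℚₚ.toℚᵘ-fromℚᵘ (ℚᵘ.mkℚᵘ a 0))) (ℚᵘₚ.≃-sym (ℚₚ.toℚᵘ-fromℚᵘ (ℚᵘ.mkℚᵘ b 0))) ⟩
  ℚ.toℚᵘ (toℚ a) ℚᵘ.+ ℚ.toℚᵘ (toℚ b)
    ≈⟨ ℚᵘₚ.≃-sym (ℚₚ.toℚᵘ-homo-+ (toℚ a) (toℚ b)) ⟩
  ℚ.toℚᵘ (toℚ a ℚ.+ toℚ b)
    ∎)
  where open ℚᵘₚ.≃-Reasoning

toℚ-* : ∀ a b → toℚ (a ℤ.* b) ≡ toℚ a *ℚ toℚ b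
toℚ-* a b = ℚₚ.toℚᵘ-injective (begin
  ℚ.toℚᵘ (toℚ (a ℤ.* b))
    ≈⟨ ℚₚ.toℚᵘ-fromℚᵘ (ℚᵘ.mkℚᵘ (a ℤ.* b) 0) ⟩
  ℚᵘ.mkℚᵘ a 0 ℚᵘ.* ℚᵘ.mkℚᵘ b 0
    ≈⟨ ℚᵘₚ.*-cong (ℚᵘₚ.≃-sym (ℚₚ.toℚᵘ-fromℚᵘ (ℚᵘ.mkℚᵘ a 0))) (ℚᵘₚ.≃-sym (ℚₚ.toℚᵘ-fromℚᵘ (ℚᵘ.mkℚᵘ b 0))) ⟩
  ℚ.toℚᵘ (toℚ a) ℚᵘ.* ℚ.toℚᵘ (toℚ b)
    ≈⟨ ℚᵘₚ.≃-sym (ℚₚ.toℚᵘ-homo-* (toℚ a) (toℚ b)) ⟩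
  ℚ.toℚᵘ (toℚ a *ℚ toℚ b)
    ∎)
  where open ℚᵘₚ.≃-Reasoning

toℚ-sumℤ : ∀ {X : Set} (h : X → ℤ) xs →
           toℚ (sumℤ (map h xs)) ≡ sumℚ (map (λ x → toℚ (h x)) xs)
toℚ-sumℤ h []       = refl
toℚ-sumℤ h (x ∷ xs) = trans (toℚ-+ (h x) _) (cong (toℚ (h x) ℚ.+_) (toℚ-sumℤ h xs))

+-sum : ∀ {X : Set} (f : X → ℕ) xs → + sum (map f xs) ≡ sumℤ (map (λ x → + f x) xs)
+-sum f []       = refl
+-sum f (x ∷ xs) = trans (ℤₚ.pos-+ (f x) _) (cong (λ y → + f x ℤ.+ y) (+-sum f xs))

*-sumℚ : ∀ {X : Set} c (h : X → ℚ) xs → c *ℚ sumℚ (map h xs) ≡ sumℚ (map (λ x → c *ℚ h x) xs)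
*-sumℚ c h []       = ℚₚ.*-zeroʳ c
*-sumℚ c h (x ∷ xs) = trans (ℚₚ.*-distribˡ-+ c (h x) _) (cong (c *ℚ h x ℚ.+_) (*-sumℚ c h xs))

2ℚ : ℚ
2ℚ = toℚ (+ 2)

powℚ-+ : ∀ x a b → powℚ x (a + b) ≡ powℚ x a *ℚ powℚ x b
powℚ-+ x zero    b = sym (ℚₚ.*-identityˡ _)
powℚ-+ x (suc a) b = trans (cong (x *ℚ_) (powℚ-+ x a b)) (sym (ℚₚ.*-assoc x _ _))

toℚ-2^ : ∀ n → toℚ (+ (2 ^ n)) ≡ powℚ 2ℚ n
toℚ-2^ zero    = refl
toℚ-2^ (suc n) =
  trans (cong toℚ (ℤₚ.pos-* 2 (2 ^ n))) (trans (toℚ-* (+ 2) (+ (2 ^ n))) (cong (2ℚ *ℚ_) (toℚ-2^ n)))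

open import Algebra.Properties.CommutativeSemigroup (commutativeSemigroup ℚₚ.*-1-isCommutativeMonoid)
  using () renaming (interchange to *ℚ-interchange; x∙yz≈y∙xz to *ℚ-x∙yz≈y∙xz)

½^*2^ : ∀ n → powℚ ½ n *ℚ powℚ 2ℚ n ≡ 1ℚ
½^*2^ zero    = refl
½^*2^ (suc n) = trans (*ℚ-interchange ½ (powℚ ½ n) 2ℚ (powℚ 2ℚ n)) (cong (1ℚ *ℚ_) (½^*2^ n))

½^*2^-trade : ∀ a b c d → b + d ≡ c + a → powℚ ½ a *ℚ powℚ 2ℚ b ≡ powℚ 2ℚ c *ℚ powℚ ½ d
½^*2^-trade a b c d b+d≡c+a = begin
  ½^ a *ℚ 2^ b
    ≡⟨ sym (ℚₚ.*-identityʳ _) ⟩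
  (½^ a *ℚ 2^ b) *ℚ 1ℚ
    ≡⟨ cong ((½^ a *ℚ 2^ b) *ℚ_) (sym (trans (ℚₚ.*-comm (2^ d) (½^ d)) (½^*2^ d))) ⟩
  (½^ a *ℚ 2^ b) *ℚ (2^ d *ℚ ½^ d)
    ≡⟨ *ℚ-interchange (½^ a) (2^ b) (2^ d) (½^ d) ⟩
  (½^ a *ℚ 2^ d) *ℚ (2^ b *ℚ ½^ d)
    ≡⟨ cong (_*ℚ (2^ b *ℚ ½^ d)) (ℚₚ.*-comm (½^ a) (2^ d)) ⟩
  (2^ d *ℚ ½^ a) *ℚ (2^ b *ℚ ½^ d)
    ≡⟨ *ℚ-interchange (2^ d) (½^ a) (2^ b) (½^ d) ⟩
  (2^ d *ℚ 2^ b) *ℚ (½^ a *ℚ ½^ d)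
    ≡⟨ cong₂ _*ℚ_ (trans (sym (powℚ-+ 2ℚ d b)) (cong (powℚ 2ℚ) (trans (+-comm d b) b+d≡c+a)))
                  (ℚₚ.*-comm (½^ a) (½^ d)) ⟩
  2^ (c + a) *ℚ (½^ d *ℚ ½^ a)
    ≡⟨ cong (_*ℚ (½^ d *ℚ ½^ a)) (powℚ-+ 2ℚ c a) ⟩
  (2^ c *ℚ 2^ a) *ℚ (½^ d *ℚ ½^ a)
    ≡⟨ *ℚ-interchange (2^ c) (2^ a) (½^ d) (½^ a) ⟩
  (2^ c *ℚ ½^ d) *ℚ (2^ a *ℚ ½^ a)
    ≡⟨ cong ((2^ c *ℚ ½^ d) *ℚ_) (trans (ℚₚ.*-comm (2^ a) (½^ a)) (½^*2^ a)) ⟩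
  (2^ c *ℚ ½^ d) *ℚ 1ℚ
    ≡⟨ ℚₚ.*-identityʳ _ ⟩
  2^ c *ℚ ½^ d
    ∎
  where
  open ≡-Reasoning
  ½^_ 2^_ : ℕ → ℚ
  ½^ n = powℚ ½ n
  2^ n = powℚ 2ℚ n

*-double : ∀ F w → (F + F) * w ≡ F * (2 * w)
*-double F w = trans (*-distribʳ-+ w F F)
  (trans (cong (λ x → F * w + F * x) (sym (+-identityʳ w))) (sym (*-distribˡ-+ F w (w + 0))))

exponents-balance : ∀ K j m → j ≤ K → 1 ≤ m → (K ∸ j) * m + m * j ≡ K * (m ∸ 1) + K
exponents-balance K j m j≤K 1≤m = begin
  (K ∸ j) * m + m * j          ≡⟨ cong (_+_ ((K ∸ j) * m)) (*-comm m j) ⟩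
  (K ∸ j) * m + j * m          ≡⟨ sym (*-distribʳ-+ m (K ∸ j) j) ⟩
  (K ∸ j + j) * m              ≡⟨ cong (_* m) (m∸n+n≡m j≤K) ⟩
  K * m                        ≡⟨ cong (K *_) (sym (m∸n+n≡m 1≤m)) ⟩
  K * (m ∸ 1 + 1)              ≡⟨ *-distribˡ-+ K (m ∸ 1) 1 ⟩
  K * (m ∸ 1) + K * 1          ≡⟨ cong (_+_ (K * (m ∸ 1))) (*-identityʳ K) ⟩
  K * (m ∸ 1) + K              ∎
  where open ≡-Reasoning

-- The even moments

module EvenMoment (s k q : ℕ) (q≥1 : 1 ≤ q) where

  private
    module Profile = KernelProfile s k

  weight : ℕ → ℕ
  weight j = 2 ^ ((suc s + suc k ∸ (j + 2)) * (2 * q))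

  cases : ℕ → Seq → ℕ
  cases j t = 𝟙 (fourRanks? (suc s) (suc k) j t) + 𝟙 (ranksJump? (suc s) (suc k) j t)

  sum-cases : ∀ t → let a = rank (D s k t) in
              sum (map (λ j → cases j t * weight j) (upTo (suc s))) ≡ cases a t * weight a
  sum-cases t = trans (cong sum (Listₚ.map-applyUpTo id (λ j → cases j t * weight j) (suc s)))
    (sum-applyUpTo-single (suc s) _ (rank (D s k t)) (s≤s (rank≤rows (D s k t)))
      (λ j j≢a → cong₂ (λ x y → (𝟙 x + 𝟙 y) * weight j) (fourRanks?-off s k j t (λ eq → j≢a (sym eq)))
                                                         (ranksJump?-off s k j t (λ eq → j≢a (sym eq)))))

  g^2q : ∀ t → g (suc s) (suc k) t ^ℤ (2 * q) ≡ + sum (map (λ j → cases j t * weight j) (upTo (suc s)))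
  g^2q t = trans (Profile.g^2q t q q≥1) (cong +_ (sym (sum-cases t)))

  ∑-g^2q : ℤ∑.∑ (s + suc k) (λ α → g (suc s) (suc k) (extend α) ^ℤ (2 * q))
           ≡ + sum (map (λ j → (N (suc s) (suc k) j + N (suc s) (suc k) j) * weight j) (upTo (suc s)))
  ∑-g^2q = begin
    ℤ∑.∑ n (λ α → g (suc s) (suc k) (extend α) ^ℤ (2 * q))
      ≡⟨ ℤ∑.∑-cong n (λ α → g^2q (extend α)) ⟩
    ℤ∑.∑ n (λ α → + sum (map (λ j → cases j (extend α) * weight j) (upTo (suc s))))
      ≡⟨ ℤ∑-+ n _ ⟩
    + ∑ n (λ α → sum (map (λ j → cases j (extend α) * weight j) (upTo (suc s))))
      ≡⟨ cong +_ (∑-sum-comm n (λ α j → cases j (extend α) * weight j) (upTo (suc s))) ⟩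
    + sum (map (λ j → ∑ n (λ α → cases j (extend α) * weight j)) (upTo (suc s)))
      ≡⟨ cong (λ xs → + sum xs) (Listₚ.map-cong ∑-cases (upTo (suc s))) ⟩
    + sum (map (λ j → (N (suc s) (suc k) j + N (suc s) (suc k) j) * weight j) (upTo (suc s)))
      ∎
    where
    open ≡-Reasoning
    n = s + suc k
    ∑-cases : ∀ j → ∑ n (λ α → cases j (extend α) * weight j)
                    ≡ (N (suc s) (suc k) j + N (suc s) (suc k) j) * weight j
    ∑-cases j = trans (∑-*ʳ n _ (weight j)) (cong (_* weight j)
      (trans (∑-distrib n _ _) (cong₂ _+_ (sym (N-as-∑ s k j)) (∑-ranksJump? s k j))))

  term : ∀ F j → j ≤ s →
         powℚ ½ (s + suc k) *ℚ toℚ (+ ((F + F) * weight j))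
         ≡ toℚ ((+ 2) ^ℤ ((suc s + suc k ∸ 2) * (2 * q ∸ 1))) *ℚ (toℚ (+ F) *ℚ powℚ ½ (2 * q * j))
  term F j j≤s = begin
    ½^ (s + suc k) *ℚ toℚ (+ ((F + F) * 2 ^ A))
      ≡⟨ cong (λ x → ½^ (s + suc k) *ℚ toℚ (+ x)) (*-double F (2 ^ A)) ⟩
    ½^ (s + suc k) *ℚ toℚ (+ (F * 2 ^ suc A))
      ≡⟨ cong (½^ (s + suc k) *ℚ_) (trans (cong toℚ (ℤₚ.pos-* F (2 ^ suc A)))
                                      (trans (toℚ-* (+ F) _) (cong (f *ℚ_) (toℚ-2^ (suc A))))) ⟩
    ½^ (s + suc k) *ℚ (f *ℚ 2^ (suc A))
      ≡⟨ *ℚ-x∙yz≈y∙xz (½^ (s + suc k)) f (2^ (suc A)) ⟩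
    f *ℚ (½^ (s + suc k) *ℚ 2^ (suc A))
      ≡⟨ cong (f *ℚ_) (½^*2^-trade (s + suc k) (suc A) C B balance) ⟩
    f *ℚ (2^ C *ℚ ½^ B)
      ≡⟨ *ℚ-x∙yz≈y∙xz f (2^ C) (½^ B) ⟩
    2^ C *ℚ (f *ℚ ½^ B)
      ≡⟨ cong (_*ℚ (f *ℚ ½^ B)) (sym (trans (cong toℚ (+2^ C)) (toℚ-2^ C))) ⟩
    toℚ ((+ 2) ^ℤ C) *ℚ (f *ℚ ½^ B)
      ∎
    where
    open ≡-Reasoning
    ½^_ 2^_ : ℕ → ℚ
    ½^ n = powℚ ½ n
    2^ n = powℚ 2ℚ n
    f = toℚ (+ F)
    K = s + k
    A = (suc s + suc k ∸ (j + 2)) * (2 * q)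
    B = 2 * q * j
    C = (suc s + suc k ∸ 2) * (2 * q ∸ 1)
    balance : suc A + B ≡ C + (s + suc k)
    balance = begin
      suc (A + B)
        ≡⟨ cong (λ e → suc (e * (2 * q) + B)) (∸-exponent s k j) ⟩
      suc ((K ∸ j) * (2 * q) + B)
        ≡⟨ cong suc (exponents-balance K j (2 * q) (≤-trans j≤s (m≤m+n s k)) (≤-trans q≥1 (m≤n*m q 2))) ⟩
      suc (K * (2 * q ∸ 1) + K)
        ≡⟨ sym (+-suc _ K) ⟩
      K * (2 * q ∸ 1) + suc K
        ≡⟨ cong₂ (λ x y → x * (2 * q ∸ 1) + y) (cong (_∸ 1) (sym (+-suc s k))) (sym (+-suc s k)) ⟩
      C + (s + suc k)
        ∎

  integral : cylinderIntegral (suc s + suc k ∸ 1) (λ t → toℚ (g (suc s) (suc k) t ^ℤ (2 * q)))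
             ≡ toℚ ((+ 2) ^ℤ ((suc s + suc k ∸ 2) * (2 * q ∸ 1)))
               *ℚ sumℚ (map (λ j → toℚ (+ N (suc s) (suc k) j) *ℚ powℚ ½ (2 * q * j)) (upTo (suc s)))
  integral = begin
    powℚ ½ n *ℚ sumℚ (map (λ α → toℚ (G α)) (allVecs n))
      ≡⟨ cong (powℚ ½ n *ℚ_) (sym (toℚ-sumℤ G (allVecs n))) ⟩
    powℚ ½ n *ℚ toℚ (sumℤ (map G (allVecs n)))
      ≡⟨ cong (λ x → powℚ ½ n *ℚ toℚ x) (trans (ℤ∑.foldr-allVecs n G) ∑-g^2q) ⟩
    powℚ ½ n *ℚ toℚ (+ sum (map summand (upTo (suc s))))
      ≡⟨ cong (powℚ ½ n *ℚ_) (trans (cong toℚ (+-sum summand (upTo (suc s))))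
                                     (toℚ-sumℤ (λ j → + summand j) (upTo (suc s)))) ⟩
    powℚ ½ n *ℚ sumℚ (map (λ j → toℚ (+ summand j)) (upTo (suc s)))
      ≡⟨ *-sumℚ (powℚ ½ n) (λ j → toℚ (+ summand j)) (upTo (suc s)) ⟩
    sumℚ (map (λ j → powℚ ½ n *ℚ toℚ (+ summand j)) (upTo (suc s)))
      ≡⟨ cong sumℚ (Listₚ.map-cong-local
                     (applyUpTo⁺₁ id (suc s) (λ j<s+1 → term (N (suc s) (suc k) _) _ (≤-pred j<s+1)))) ⟩
    sumℚ (map (λ j → c *ℚ R j) (upTo (suc s)))
      ≡⟨ sym (*-sumℚ c R (upTo (suc s))) ⟩
    c *ℚ sumℚ (map R (upTo (suc s)))
      ∎
    where
    open ≡-Reasoning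
    n = s + suc k
    G : Vec Bool n → ℤ
    G α = g (suc s) (suc k) (extend α) ^ℤ (2 * q)
    summand : ℕ → ℕ
    summand j = (N (suc s) (suc k) j + N (suc s) (suc k) j) * weight j
    c = toℚ ((+ 2) ^ℤ ((suc s + suc k ∸ 2) * (2 * q ∸ 1)))
    R : ℕ → ℚ
    R j = toℚ (+ N (suc s) (suc k) j) *ℚ powℚ ½ (2 * q * j)

theorem1p5 : (s k q : ℕ) → 2 ≤ s → 2 ≤ k → 1 ≤ q →
    ((t : Seq) → (j : ℕ) →
      (rank (D (s ∸ 1) (k ∸ 1) t) ≡ j → rank (D s (k ∸ 1) t) ≡ j →
       rank (D (s ∸ 1) k t) ≡ j → rank (D s k t) ≡ j →
       g s k t ≡ (+ 2) ^ℤ (s + k ∸ (j + 2)))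
      ×
      (rank (D (s ∸ 1) (k ∸ 1) t) ≡ j → rank (D s (k ∸ 1) t) ≡ j →
       rank (D (s ∸ 1) k t) ≡ j → rank (D s k t) ≡ j + 1 →
       g s k t ≡ - ((+ 2) ^ℤ (s + k ∸ (j + 2)))))
    ×
    ((t : Seq) →
      ((j : ℕ) →
        ¬ (rank (D (s ∸ 1) (k ∸ 1) t) ≡ j × rank (D s (k ∸ 1) t) ≡ j ×
           rank (D (s ∸ 1) k t) ≡ j × rank (D s k t) ≡ j)
        ×
        ¬ (rank (D (s ∸ 1) (k ∸ 1) t) ≡ j × rank (D s (k ∸ 1) t) ≡ j ×
           rank (D (s ∸ 1) k t) ≡ j × rank (D s k t) ≡ j + 1)) →
      g s k t ≡ + 0)
    ×
    ((t t' : Seq) → ((i : ℕ) → i < s + k ∸ 1 → t i ≡ t' i) → g s k t ≡ g s k t')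
    ×
    (cylinderIntegral (s + k ∸ 1) (λ t → toℚ (g s k t ^ℤ (2 * q)))
      ≡ toℚ ((+ 2) ^ℤ ((s + k ∸ 2) * (2 * q ∸ 1)))
        *ℚ sumℚ (map (λ j → toℚ (+ N s k j) *ℚ powℚ ½ (2 * q * j)) (upTo s)))
theorem1p5 zero    k       q ()  _  _
theorem1p5 (suc s) zero    q _   () _
theorem1p5 (suc s) (suc k) q _   _  q≥1 =
  (λ t j → (λ ra rb rc rd → KernelProfile.g-fourRanks s k t j (ra , rb , rc , rd)) ,
           (λ ra rb rc rd → KernelProfile.g-ranksJump s k t j (ra , rb , rc , rd))) ,
  (λ t → KernelProfile.g-vanishes s k t) ,
  (λ t t′ → g-local s k) ,
  EvenMoment.integral s k q q≥1
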